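{- Let $X$ be a finite simple graph on $n$ vertices with adjacency matrix $A$, and let $u$ and $v$ be vertices of $X$ with respective walk matrices $W_u$ and $W_v$. If $u$ and $v$ are controllable and $Q:=W_vW_u^{ -1}$, then $Q$ is a polynomial in $A$. Further, $Q$ is orthogonal if and only if $u$ and $v$ are cospectral.
   Context: The walk matrix $W_w$ of a vertex $w$ is the $n\times n$ matrix with columns $e_w,Ae_w,\dots,A^{n-1}e_w$ ($e_w$ the standard basis vector of $w$); $w$ is controllable if $W_w$ is invertible. Vertices $u,v$ are cospectral if $X\setminus u$ and $X\setminus v$ have the same characteristic polynomial. -}

module Defs where

open import Data.Nat using (ℕ; zero; suc)
open import Data.Fin using (Fin; zero; suc; punchIn; _≟_)
open import Data.Bool using (Bool; true; false; if_then_else_)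
open import Data.List using (List; []; _∷_)
open import Data.Rational using (ℚ; 0ℚ; 1ℚ; _+_; _*_; -_)
open import Relation.Binary.PropositionalEquality using (_≡_)
open import Relation.Nullary.Decidable using (does)
open import Data.Product using (_×_; Σ)

record SimpleGraph (n : ℕ) : Set where
  field
    adj     : Fin n → Fin n → Bool
    symm    : ∀ i j → adj i j ≡ adj j i
    irrefl  : ∀ i → adj i i ≡ false

Mat : ℕ → Set
Mat n = Fin n → Fin n → ℚ

Σℚ : ∀ {n} → (Fin n → ℚ) → ℚ
Σℚ {zero}  f = 0ℚ
Σℚ {suc n} f = f zero + Σℚ (λ i → f (suc i))

_⊗_ : ∀ {n} → Mat n → Mat n → Mat n
(M ⊗ N) i j = Σℚ (λ k → M i k * N k j)

idM : ∀ {n} → Mat n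
idM i j = if does (i ≟ j) then 1ℚ else 0ℚ

zeroM : ∀ {n} → Mat n
zeroM i j = 0ℚ

_⊕_ : ∀ {n} → Mat n → Mat n → Mat n
(M ⊕ N) i j = M i j + N i j

scaleM : ∀ {n} → ℚ → Mat n → Mat n
scaleM c M i j = c * M i j

transpose : ∀ {n} → Mat n → Mat n
transpose M i j = M j i

_^M_ : ∀ {n} → Mat n → ℕ → Mat n
M ^M zero  = idM
M ^M suc k = M ⊗ (M ^M k)

_≈M_ : ∀ {n} → Mat n → Mat n → Set
M ≈M N = ∀ i j → M i j ≡ N i j

IsInverse : ∀ {n} → Mat n → Mat n → Set
IsInverse M N = ((M ⊗ N) ≈M idM) × ((N ⊗ M) ≈M idM)

Invertible : ∀ {n} → Mat n → Set
Invertible M = Σ (Mat _) (λ N → IsInverse M N)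

Orthogonal : ∀ {n} → Mat n → Set
Orthogonal Q = (transpose Q ⊗ Q) ≈M idM

evalPolyM : ∀ {n} → List ℚ → Mat n → Mat n
evalPolyM []       M = zeroM
evalPolyM (c ∷ cs) M = scaleM c idM ⊕ (M ⊗ evalPolyM cs M)

IsPolynomialIn : ∀ {n} → Mat n → Mat n → Set
IsPolynomialIn Q A = Σ (List ℚ) (λ p → Q ≈M evalPolyM p A)

adjMat : ∀ {n} → SimpleGraph n → Mat n
adjMat X i j = if SimpleGraph.adj X i j then 1ℚ else 0ℚ

-- walk matrix W_w: column k is A^k e_w, i.e. entry (i,k) is (A^k)_{i w}
walkMat : ∀ {n} → SimpleGraph n → Fin n → Mat n
walkMat X w i k = (adjMat X ^M Data.Fin.toℕ k) i w

Controllable : ∀ {n} → SimpleGraph n → Fin n → Set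
Controllable X w = Invertible (walkMat X w)

-- adjacency matrix of the vertex-deleted subgraph X \ u
deleteAdj : ∀ {m} → SimpleGraph (suc m) → Fin (suc m) → Mat m
deleteAdj X u i j = adjMat X (punchIn u i) (punchIn u j)

-- Polynomials over ℚ as coefficient lists (lowest degree first)

Poly : Set
Poly = List ℚ

coeff : Poly → ℕ → ℚ
coeff []       k       = 0ℚ
coeff (c ∷ cs) zero    = c
coeff (c ∷ cs) (suc k) = coeff cs k

_≈P_ : Poly → Poly → Set
p ≈P q = ∀ k → coeff p k ≡ coeff q k

_+P_ : Poly → Poly → Poly
[]       +P q        = q
(a ∷ p)  +P []       = a ∷ p
(a ∷ p)  +P (b ∷ q)  = (a + b) ∷ (p +P q)

scaleP : ℚ → Poly → Poly
scaleP c []       = []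
scaleP c (a ∷ p)  = (c * a) ∷ scaleP c p

_*P_ : Poly → Poly → Poly
[]      *P q = []
(a ∷ p) *P q = scaleP a q +P (0ℚ ∷ (p *P q))

-P_ : Poly → Poly
-P p = scaleP (- 1ℚ) p

constP : ℚ → Poly
constP c = c ∷ []

xP : Poly
xP = 0ℚ ∷ 1ℚ ∷ []

ΣP : ∀ {n} → (Fin n → Poly) → Poly
ΣP {zero}  f = []
ΣP {suc n} f = f zero +P ΣP (λ i → f (suc i))

signP : ℕ → Poly → Poly
signP zero          p = p
signP (suc zero)    p = -P p
signP (suc (suc k)) p = signP k p

detP : ∀ {n} → (Fin n → Fin n → Poly) → Poly
detP {zero}  M = constP 1ℚ
detP {suc n} M =
  ΣP (λ j → signP (Data.Fin.toℕ j)
               (M zero j *P detP (λ i k → M (suc i) (punchIn j k))))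

charPoly : ∀ {n} → Mat n → Poly
charPoly M = detP (λ i j → (if does (i ≟ j) then xP else []) +P (-P constP (M i j)))

Cospectral : ∀ {m} → SimpleGraph (suc m) → Fin (suc m) → Fin (suc m) → Set
Cospectral X u v = charPoly (deleteAdj X u) ≈P charPoly (deleteAdj X v)

-- Polynomial: for c the v-th column of W_u⁻¹, p(A) = Σ_k c_k A^k commutes with
-- every A^l and p(A) e_u = W_u c = e_v, so p(A) W_u = W_v and Q = p(A).
-- Orthogonality: Q W_u = W_v, so QᵀQ = I iff W_uᵀW_u = W_vᵀW_v; as A is
-- symmetric these Gram matrices have entries (A^(j+k))_ww, so this says that u
-- and v lie on equally many closed walks of each length (lengths < n suffice,
-- by the Cayley–Hamilton recurrence).  Cospectrality: φ(X∖w) is the (w,w)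
-- cofactor of xI - A, and the adjugate identity of xI - A read coefficientwise
-- is a unitriangular system linking its coefficients to these closed walk counts.
module Submission where

open import Defs
open import Level using (0ℓ)
open import Data.Nat as ℕ using (ℕ; zero; suc; z≤n; s≤s; _∸_)
import Data.Nat.Properties as NP
open import Data.Nat.Induction using (<-rec)
open import Data.Fin as F using (Fin; zero; suc; punchIn; punchOut; toℕ; _≟_; inject₁)
import Data.Fin.Properties as FP
open import Data.Bool using (Bool; true; false; if_then_else_)
open import Data.Rational as Q using (ℚ; 0ℚ; 1ℚ; _+_; _*_; -_)
import Data.Rational.Properties as QP
open import Data.List using ([]; _∷_; tabulate; length)
open import Data.Product using (_×_; _,_; proj₁; proj₂)
open import Data.Maybe.Base using (Maybe; just; nothing)
open import Data.Empty using (⊥-elim)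
open import Data.Unit using (tt)
open import Function using (_∘_)
open import Function.Bundles using (_⇔_; mk⇔)
import Function.Properties.Equivalence as ⇔
open import Relation.Binary.PropositionalEquality
open import Relation.Binary.Bundles using (Setoid)
open import Relation.Binary.Definitions using (tri<; tri≈; tri>)
open import Relation.Nullary using (yes; no; does; ¬_; Dec)
open import Relation.Nullary.Decidable using (toWitness; dec-true; dec-false)
open import Algebra.Bundles using (CommutativeRing)
open import Algebra.Properties.Semiring.Sum (CommutativeRing.semiring QP.+-*-commutativeRing)
  using (sum; sum-cong-≗; sum-replicate-zero; ∑-distrib-+; *-distribˡ-sum; ∑-comm; sum-remove)
open import Tactic.RingSolver using (solve-∀)
open import Tactic.RingSolver.Core.AlmostCommutativeRing using (AlmostCommutativeRing; fromCommutativeRing)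
import Relation.Binary.Reasoning.Setoid as SetoidReasoning
open import Algebra.Properties.Ring QP.+-*-ring using (-‿involutive; -1*x≈-x; +-cancelˡ)

-- ℚ as a ring for the reflective ring solver ('solve-∀ ℚ-ring'); the
-- solver needs to recognise zero coefficients to normalise polynomials.
ℚ-ring : AlmostCommutativeRing 0ℓ 0ℓ
ℚ-ring = fromCommutativeRing QP.+-*-commutativeRing isZero
  where
  isZero : ∀ x → Maybe (0ℚ ≡ x)
  isZero x with 0ℚ QP.≟ x
  ... | yes 0≡x = just 0≡x
  ... | no  _   = nothing

-- Finite sums.  'Σℚ' is the library's semiring sum, so the library's
-- summation lemmas transfer to it.
Σℚ≡sum : ∀ {n} (f : Fin n → ℚ) → Σℚ f ≡ sum f
Σℚ≡sum {zero}  f = refl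
Σℚ≡sum {suc n} f = cong (f zero +_) (Σℚ≡sum (f ∘ suc))

Σ-cong : ∀ {n} {f g : Fin n → ℚ} → (∀ i → f i ≡ g i) → Σℚ f ≡ Σℚ g
Σ-cong {f = f} {g} e = trans (Σℚ≡sum f) (trans (sum-cong-≗ e) (sym (Σℚ≡sum g)))

Σ-zero : ∀ {n} → Σℚ {n} (λ _ → 0ℚ) ≡ 0ℚ
Σ-zero {n} = trans (Σℚ≡sum {n} (λ _ → 0ℚ)) (sum-replicate-zero n)

Σ-+ : ∀ {n} (f g : Fin n → ℚ) → Σℚ (λ i → f i + g i) ≡ Σℚ f + Σℚ g
Σ-+ f g = trans (Σℚ≡sum (λ i → f i + g i))
  (trans (∑-distrib-+ f g) (sym (cong₂ _+_ (Σℚ≡sum f) (Σℚ≡sum g))))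

Σ-*ˡ : ∀ {n} (c : ℚ) (f : Fin n → ℚ) → Σℚ (λ i → c * f i) ≡ c * Σℚ f
Σ-*ˡ c f = trans (Σℚ≡sum (λ i → c * f i))
  (trans (sym (*-distribˡ-sum c f)) (cong (c *_) (sym (Σℚ≡sum f))))

Σ-*ʳ : ∀ {n} (c : ℚ) (f : Fin n → ℚ) → Σℚ (λ i → f i * c) ≡ Σℚ f * c
Σ-*ʳ c f = trans (Σ-cong (λ i → QP.*-comm (f i) c)) (trans (Σ-*ˡ c f) (QP.*-comm c _))

Σ-neg : ∀ {n} (f : Fin n → ℚ) → Σℚ (λ i → - f i) ≡ - Σℚ f
Σ-neg {zero}  f = refl
Σ-neg {suc n} f =
  trans (cong ((- f zero) +_) (Σ-neg (f ∘ suc))) (sym (QP.neg-distrib-+ (f zero) _))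

Σ-swap : ∀ {m n} (f : Fin m → Fin n → ℚ) →
         Σℚ (λ i → Σℚ (λ j → f i j)) ≡ Σℚ (λ j → Σℚ (λ i → f i j))
Σ-swap f = trans (nested f) (trans (∑-comm f) (sym (nested (λ j i → f i j))))
  where
  nested : ∀ {m n} (g : Fin m → Fin n → ℚ) → Σℚ (λ i → Σℚ (g i)) ≡ sum (λ i → sum (g i))
  nested g = trans (Σℚ≡sum (λ i → Σℚ (g i))) (sum-cong-≗ (λ i → Σℚ≡sum (g i)))

Σ-punchIn : ∀ {n} (j : Fin (suc n)) (f : Fin (suc n) → ℚ) →
            Σℚ f ≡ f j + Σℚ (λ l → f (punchIn j l))
Σ-punchIn j f = trans (Σℚ≡sum f)
  (trans (sum-remove {i = j} f) (cong (f j +_) (sym (Σℚ≡sum (λ l → f (punchIn j l))))))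

Σ-idMˡ : ∀ {n} (i : Fin n) (f : Fin n → ℚ) → Σℚ (λ k → idM i k * f k) ≡ f i
Σ-idMˡ {suc n} zero f = trans
  (cong₂ _+_ (QP.*-identityˡ (f zero))
             (trans (Σ-cong (λ k → QP.*-zeroˡ (f (suc k)))) (Σ-zero {n})))
  (QP.+-identityʳ _)
Σ-idMˡ {suc n} (suc i) f =
  trans (cong₂ _+_ (QP.*-zeroˡ (f zero)) (Σ-idMˡ i (f ∘ suc))) (QP.+-identityˡ _)

idM-sym : ∀ {n} (k j : Fin n) → idM k j ≡ idM j k
idM-sym zero    zero    = refl
idM-sym zero    (suc j) = refl
idM-sym (suc k) zero    = refl
idM-sym (suc k) (suc j) = idM-sym k j

Σ-idMʳ : ∀ {n} (j : Fin n) (f : Fin n → ℚ) → Σℚ (λ k → f k * idM k j) ≡ f j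
Σ-idMʳ j f = trans (Σ-cong (λ k → QP.*-comm (f k) (idM k j)))
  (trans (Σ-cong (λ k → cong (_* f k) (idM-sym k j))) (Σ-idMˡ j f))

≈M-refl : ∀ {n} {M : Mat n} → M ≈M M
≈M-refl i j = refl

≈M-sym : ∀ {n} {M N : Mat n} → M ≈M N → N ≈M M
≈M-sym e i j = sym (e i j)

≈M-trans : ∀ {n} {M N P : Mat n} → M ≈M N → N ≈M P → M ≈M P
≈M-trans e f i j = trans (e i j) (f i j)

matSetoid : ℕ → Setoid 0ℓ 0ℓ
matSetoid n = record
  { Carrier = Mat n ; _≈_ = _≈M_
  ; isEquivalence = record { refl = ≈M-refl ; sym = ≈M-sym ; trans = ≈M-trans } }

⊗-cong : ∀ {n} {M M′ N N′ : Mat n} → M ≈M M′ → N ≈M N′ → (M ⊗ N) ≈M (M′ ⊗ N′)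
⊗-cong e f i j = Σ-cong (λ k → cong₂ _*_ (e i k) (f k j))

⊗-congˡ : ∀ {n} (M : Mat n) {N N′ : Mat n} → N ≈M N′ → (M ⊗ N) ≈M (M ⊗ N′)
⊗-congˡ M = ⊗-cong (≈M-refl {M = M})

⊗-congʳ : ∀ {n} (N : Mat n) {M M′ : Mat n} → M ≈M M′ → (M ⊗ N) ≈M (M′ ⊗ N)
⊗-congʳ N e = ⊗-cong e (≈M-refl {M = N})

⊗-assoc : ∀ {n} (M N P : Mat n) → ((M ⊗ N) ⊗ P) ≈M (M ⊗ (N ⊗ P))
⊗-assoc M N P i j = begin
    Σℚ (λ k → Σℚ (λ l → M i l * N l k) * P k j)
  ≡⟨ Σ-cong (λ k → sym (Σ-*ʳ (P k j) (λ l → M i l * N l k))) ⟩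
    Σℚ (λ k → Σℚ (λ l → M i l * N l k * P k j))
  ≡⟨ Σ-swap (λ k l → M i l * N l k * P k j) ⟩
    Σℚ (λ l → Σℚ (λ k → M i l * N l k * P k j))
  ≡⟨ Σ-cong (λ l → trans (Σ-cong (λ k → QP.*-assoc (M i l) (N l k) (P k j)))
                         (Σ-*ˡ (M i l) (λ k → N l k * P k j))) ⟩
    Σℚ (λ l → M i l * Σℚ (λ k → N l k * P k j)) ∎
  where open ≡-Reasoning

⊗-identityˡ : ∀ {n} (M : Mat n) → (idM ⊗ M) ≈M M
⊗-identityˡ M i j = Σ-idMˡ i (λ k → M k j)

⊗-identityʳ : ∀ {n} (M : Mat n) → (M ⊗ idM) ≈M M
⊗-identityʳ M i j = Σ-idMʳ j (λ k → M i k)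

transpose-cong : ∀ {n} {M N : Mat n} → M ≈M N → transpose M ≈M transpose N
transpose-cong e i j = e j i

transpose-⊗ : ∀ {n} (M N : Mat n) → transpose (M ⊗ N) ≈M (transpose N ⊗ transpose M)
transpose-⊗ M N i j = Σ-cong (λ k → QP.*-comm (M j k) (N k i))

^M-+ : ∀ {n} (A : Mat n) j k → (A ^M (j ℕ.+ k)) ≈M ((A ^M j) ⊗ (A ^M k))
^M-+ A zero    k = ≈M-sym (⊗-identityˡ _)
^M-+ A (suc j) k = ≈M-trans (⊗-congˡ A (^M-+ A j k)) (≈M-sym (⊗-assoc A (A ^M j) (A ^M k)))

^M-comm : ∀ {n} (A : Mat n) j k → ((A ^M j) ⊗ (A ^M k)) ≈M ((A ^M k) ⊗ (A ^M j))
^M-comm A j k = ≈M-trans (≈M-sym (^M-+ A j k))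
  (≈M-trans (λ a b → cong (λ e → (A ^M e) a b) (NP.+-comm j k)) (^M-+ A k j))

⊗-^M-comm : ∀ {n} (A : Mat n) k → (A ⊗ (A ^M k)) ≈M ((A ^M k) ⊗ A)
⊗-^M-comm A zero    = ≈M-trans (⊗-identityʳ A) (≈M-sym (⊗-identityˡ A))
⊗-^M-comm A (suc k) = ≈M-trans (⊗-congˡ A (⊗-^M-comm A k)) (≈M-sym (⊗-assoc A (A ^M k) A))

^M-sym : ∀ {n} (A : Mat n) → (∀ i j → A i j ≡ A j i) → ∀ k i j → (A ^M k) i j ≡ (A ^M k) j i
^M-sym A s zero    i j = idM-sym i j
^M-sym A s (suc k) i j = begin
    Σℚ (λ l → A i l * (A ^M k) l j)
  ≡⟨ ⊗-^M-comm A k i j ⟩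
    Σℚ (λ l → (A ^M k) i l * A l j)
  ≡⟨ Σ-cong (λ l → trans (QP.*-comm ((A ^M k) i l) (A l j))
                         (cong₂ _*_ (s l j) (^M-sym A s k i l))) ⟩
    Σℚ (λ l → A j l * (A ^M k) l i) ∎
  where open ≡-Reasoning

-- The Krylov matrix of A at w, with columns e_w, A e_w, …, A^(n-1) e_w;
-- the walk matrix of a vertex is the Krylov matrix of the adjacency matrix.
krylov : ∀ {n} → Mat n → Fin n → Mat n
krylov A w i k = (A ^M toℕ k) i w

powComb : ∀ {n m} → (Fin m → ℚ) → Mat n → Mat n
powComb c A i j = Σℚ (λ k → c k * (A ^M toℕ k) i j)

⊗-powComb : ∀ {n m} (N : Mat n) (c : Fin m → ℚ) (A : Mat n) i j →
            (N ⊗ powComb c A) i j ≡ Σℚ (λ k → c k * (N ⊗ (A ^M toℕ k)) i j)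
⊗-powComb N c A i j = begin
    Σℚ (λ l → N i l * Σℚ (λ k → c k * (A ^M toℕ k) l j))
  ≡⟨ Σ-cong (λ l → sym (Σ-*ˡ (N i l) (λ k → c k * (A ^M toℕ k) l j))) ⟩
    Σℚ (λ l → Σℚ (λ k → N i l * (c k * (A ^M toℕ k) l j)))
  ≡⟨ Σ-swap (λ l k → N i l * (c k * (A ^M toℕ k) l j)) ⟩
    Σℚ (λ k → Σℚ (λ l → N i l * (c k * (A ^M toℕ k) l j)))
  ≡⟨ Σ-cong (λ k → trans (Σ-cong (λ l → swap (N i l) (c k) ((A ^M toℕ k) l j)))
                         (Σ-*ˡ (c k) (λ l → N i l * (A ^M toℕ k) l j))) ⟩
    Σℚ (λ k → c k * Σℚ (λ l → N i l * (A ^M toℕ k) l j)) ∎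
  where
  open ≡-Reasoning
  swap : ∀ x y z → x * (y * z) ≡ y * (x * z)
  swap = solve-∀ ℚ-ring

powComb-⊗ : ∀ {n m} (c : Fin m → ℚ) (A N : Mat n) i j →
            (powComb c A ⊗ N) i j ≡ Σℚ (λ k → c k * ((A ^M toℕ k) ⊗ N) i j)
powComb-⊗ c A N i j = begin
    Σℚ (λ l → Σℚ (λ k → c k * (A ^M toℕ k) i l) * N l j)
  ≡⟨ Σ-cong (λ l → sym (Σ-*ʳ (N l j) (λ k → c k * (A ^M toℕ k) i l))) ⟩
    Σℚ (λ l → Σℚ (λ k → c k * (A ^M toℕ k) i l * N l j))
  ≡⟨ Σ-swap (λ l k → c k * (A ^M toℕ k) i l * N l j) ⟩
    Σℚ (λ k → Σℚ (λ l → c k * (A ^M toℕ k) i l * N l j))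
  ≡⟨ Σ-cong (λ k → trans (Σ-cong (λ l → QP.*-assoc (c k) ((A ^M toℕ k) i l) (N l j)))
                         (Σ-*ˡ (c k) (λ l → (A ^M toℕ k) i l * N l j))) ⟩
    Σℚ (λ k → c k * Σℚ (λ l → (A ^M toℕ k) i l * N l j)) ∎
  where open ≡-Reasoning

powComb-comm-^M : ∀ {n m} (c : Fin m → ℚ) (A : Mat n) l →
                  (powComb c A ⊗ (A ^M l)) ≈M ((A ^M l) ⊗ powComb c A)
powComb-comm-^M c A l i j =
  trans (powComb-⊗ c A (A ^M l) i j)
        (trans (Σ-cong (λ k → cong (c k *_) (^M-comm A (toℕ k) l i j)))
               (sym (⊗-powComb (A ^M l) c A i j)))

evalPolyM-tabulate : ∀ {n m} (A : Mat n) (c : Fin m → ℚ) → evalPolyM (tabulate c) A ≈M powComb c A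
evalPolyM-tabulate {m = zero}  A c i j = refl
evalPolyM-tabulate {m = suc m} A c i j = cong (c zero * idM i j +_) (begin
    Σℚ (λ l → A i l * evalPolyM (tabulate (c ∘ suc)) A l j)
  ≡⟨ Σ-cong (λ l → cong (A i l *_) (evalPolyM-tabulate A (c ∘ suc) l j)) ⟩
    Σℚ (λ l → A i l * powComb (c ∘ suc) A l j)
  ≡⟨ ⊗-powComb A (c ∘ suc) A i j ⟩
    Σℚ (λ k → c (suc k) * Σℚ (λ l → A i l * (A ^M toℕ k) l j)) ∎)
  where open ≡-Reasoning

-- With c the v-th column of a right inverse of W_u = krylov A u, the matrix
-- p(A) = Σ_k c_k A^k maps W_u to W_v:
--   p(A) A^l e_u = A^l p(A) e_u = A^l W_u W_u⁻¹ e_v = A^l e_v.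
powComb-krylov : ∀ {n} (A : Mat n) (u v : Fin n) (Wu⁻¹ : Mat n) →
                 (krylov A u ⊗ Wu⁻¹) ≈M idM →
                 (powComb (λ k → Wu⁻¹ k v) A ⊗ krylov A u) ≈M krylov A v
powComb-krylov A u v Wu⁻¹ inv i l = begin
    (P ⊗ (A ^M toℕ l)) i u
  ≡⟨ powComb-comm-^M c A (toℕ l) i u ⟩
    Σℚ (λ j → (A ^M toℕ l) i j * P j u)
  ≡⟨ Σ-cong (λ j → cong ((A ^M toℕ l) i j *_) (P-column j)) ⟩
    Σℚ (λ j → (A ^M toℕ l) i j * idM j v)
  ≡⟨ Σ-idMʳ v (λ j → (A ^M toℕ l) i j) ⟩
    (A ^M toℕ l) i v ∎
  where
  open ≡-Reasoning
  c : Fin _ → ℚ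
  c k = Wu⁻¹ k v
  P : Mat _
  P = powComb c A
  -- p(A) e_u = W_u W_u⁻¹ e_v = e_v
  P-column : ∀ j → P j u ≡ idM j v
  P-column j = trans (Σ-cong (λ k → QP.*-comm (c k) ((A ^M toℕ k) j u))) (inv j v)

quotient-isPolynomial : ∀ {n} (A : Mat n) (u v : Fin n) (Wu⁻¹ : Mat n) →
                        (krylov A u ⊗ Wu⁻¹) ≈M idM →
                        IsPolynomialIn (krylov A v ⊗ Wu⁻¹) A
quotient-isPolynomial A u v Wu⁻¹ inv = tabulate c , (begin
    krylov A v ⊗ Wu⁻¹
  ≈⟨ ⊗-congʳ Wu⁻¹ (≈M-sym (powComb-krylov A u v Wu⁻¹ inv)) ⟩
    (P ⊗ krylov A u) ⊗ Wu⁻¹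
  ≈⟨ ⊗-assoc P (krylov A u) Wu⁻¹ ⟩
    P ⊗ (krylov A u ⊗ Wu⁻¹)
  ≈⟨ ⊗-congˡ P inv ⟩
    P ⊗ idM
  ≈⟨ ⊗-identityʳ P ⟩
    P
  ≈⟨ ≈M-sym (evalPolyM-tabulate A c) ⟩
    evalPolyM (tabulate c) A ∎)
  where
  open SetoidReasoning (matSetoid _)
  c : Fin _ → ℚ
  c k = Wu⁻¹ k v
  P : Mat _
  P = powComb c A

*-zero-cancelˡ : ∀ x y → x * y ≡ 0ℚ → ¬ (x ≡ 0ℚ) → y ≡ 0ℚ
*-zero-cancelˡ x y e x≢0 = begin
    y                   ≡⟨ sym (QP.*-identityˡ y) ⟩
    1ℚ * y              ≡⟨ cong (_* y) (sym (QP.*-inverseˡ x)) ⟩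
    Q.1/ x * x * y      ≡⟨ QP.*-assoc (Q.1/ x) x y ⟩
    Q.1/ x * (x * y)    ≡⟨ cong (Q.1/ x *_) e ⟩
    Q.1/ x * 0ℚ         ≡⟨ QP.*-zeroʳ (Q.1/ x) ⟩
    0ℚ                  ∎
  where
  open ≡-Reasoning
  instance
    x≠0 : Q.NonZero x
    x≠0 = Q.≢-nonZero x≢0

x≡-x⇒x≡0 : ∀ x → x ≡ - x → x ≡ 0ℚ
x≡-x⇒x≡0 x e = *-zero-cancelˡ (1ℚ + 1ℚ) x
  (trans (double x) (trans (cong (x +_) e) (QP.+-inverseʳ x))) (λ ())
  where
  double : ∀ x → (1ℚ + 1ℚ) * x ≡ x + x
  double = solve-∀ ℚ-ring

sign : ℕ → ℚ → ℚ
sign zero          x = x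
sign (suc zero)    x = - x
sign (suc (suc k)) x = sign k x

sign-suc : ∀ k x → sign (suc k) x ≡ - sign k x
sign-suc zero    x = refl
sign-suc (suc k) x = trans (sym (-‿involutive (sign k x))) (cong -_ (sym (sign-suc k x)))

sign-scalar : ∀ k x → sign k x ≡ sign k 1ℚ * x
sign-scalar zero    x = sym (QP.*-identityˡ x)
sign-scalar (suc k) x = begin
    sign (suc k) x         ≡⟨ sign-suc k x ⟩
    - sign k x             ≡⟨ cong -_ (sign-scalar k x) ⟩
    - (sign k 1ℚ * x)      ≡⟨ QP.neg-distribˡ-* (sign k 1ℚ) x ⟩
    - sign k 1ℚ * x        ≡⟨ cong (_* x) (sym (sign-suc k 1ℚ)) ⟩
    sign (suc k) 1ℚ * x    ∎
  where open ≡-Reasoning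

sign-+ : ∀ j k x → sign (j ℕ.+ k) x ≡ sign j (sign k x)
sign-+ zero    k x = refl
sign-+ (suc j) k x =
  trans (sign-suc (j ℕ.+ k) x) (trans (cong -_ (sign-+ j k x)) (sym (sign-suc j (sign k x))))

sign-double : ∀ k x → sign (k ℕ.+ k) x ≡ x
sign-double zero    x = refl
sign-double (suc k) x rewrite NP.+-suc k k = sign-double k x

sign-*ˡ : ∀ k c x → sign k (c * x) ≡ c * sign k x
sign-*ˡ k c x = trans (sign-scalar k (c * x))
  (trans (swap (sign k 1ℚ) c x) (cong (c *_) (sym (sign-scalar k x))))
  where
  swap : ∀ s c x → s * (c * x) ≡ c * (s * x)
  swap = solve-∀ ℚ-ring

sign-neg : ∀ k x → sign k (- x) ≡ - sign k x
sign-neg k x = trans (sign-scalar k (- x))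
  (trans (sym (QP.neg-distribʳ-* (sign k 1ℚ) x)) (cong -_ (sym (sign-scalar k x))))

sign-zero : ∀ k → sign k 0ℚ ≡ 0ℚ
sign-zero k = trans (sign-scalar k 0ℚ) (QP.*-zeroʳ (sign k 1ℚ))

-- Determinants over ℚ by Laplace expansion along row 0; this mirrors
-- 'detP', so that evaluating 'detP' at a point gives 'det'.
minor : ∀ {n} → Mat (suc n) → Fin (suc n) → Mat n
minor M j i k = M (suc i) (punchIn j k)

det : ∀ {n} → Mat n → ℚ
det {zero}  M = 1ℚ
det {suc n} M = Σℚ (λ j → sign (toℕ j) (M zero j * det (minor M j)))

det-cong : ∀ {n} {M N : Mat n} → M ≈M N → det M ≡ det N
det-cong {zero}  e = refl
det-cong {suc n} e = Σ-cong (λ j → cong (sign (toℕ j))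
  (cong₂ _*_ (e zero j) (det-cong (λ a b → e (suc a) (punchIn j b)))))

permuteRows : ∀ {n} → Mat n → (Fin n → Fin n) → Mat n
permuteRows M σ i k = M (σ i) k

-- The transposition of the neighbouring indices u and u+1 (for u : Fin n).
swapAdjacent : ∀ {n} → Fin n → Fin (suc n) → Fin (suc n)
swapAdjacent zero    zero          = suc zero
swapAdjacent zero    (suc zero)    = zero
swapAdjacent zero    (suc (suc x)) = suc (suc x)
swapAdjacent (suc u) zero          = zero
swapAdjacent (suc u) (suc x)       = suc (swapAdjacent u x)

-- Two ways of deleting two distinct columns a and b leave the same columns …
punchIn-punchOut-comm : ∀ {n} (a b : Fin (suc (suc n))) (a≢b : a ≢ b) (b≢a : b ≢ a) (y : Fin n) →
  punchIn a (punchIn (punchOut a≢b) y) ≡ punchIn b (punchIn (punchOut b≢a) y)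
punchIn-punchOut-comm zero    zero    a≢b b≢a y = ⊥-elim (a≢b refl)
punchIn-punchOut-comm zero    (suc b) a≢b b≢a y = refl
punchIn-punchOut-comm (suc a) zero    a≢b b≢a y = refl
punchIn-punchOut-comm {suc n} (suc a) (suc b) a≢b b≢a zero    = refl
punchIn-punchOut-comm {suc n} (suc a) (suc b) a≢b b≢a (suc y) =
  cong suc (punchIn-punchOut-comm a b (a≢b ∘ cong suc) (b≢a ∘ cong suc) y)

-- … and the signs of the two orders are opposite.
sign-punchOut-anticomm : ∀ {n} (a b : Fin (suc n)) (a≢b : a ≢ b) (b≢a : b ≢ a) →
  sign (toℕ a ℕ.+ toℕ (punchOut a≢b)) 1ℚ ≡ - sign (toℕ b ℕ.+ toℕ (punchOut b≢a)) 1ℚ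
sign-punchOut-anticomm zero zero a≢b b≢a = ⊥-elim (a≢b refl)
sign-punchOut-anticomm {suc n} zero (suc b) a≢b b≢a = begin
    sign (toℕ b) 1ℚ                   ≡⟨ sym (-‿involutive _) ⟩
    - - sign (toℕ b) 1ℚ               ≡⟨ cong -_ (sym (sign-suc (toℕ b) 1ℚ)) ⟩
    - sign (suc (toℕ b)) 1ℚ           ≡⟨ cong (λ k → - sign k 1ℚ) (sym (NP.+-identityʳ (suc (toℕ b)))) ⟩
    - sign (suc (toℕ b) ℕ.+ 0) 1ℚ     ∎
  where open ≡-Reasoning
sign-punchOut-anticomm {suc n} (suc a) zero a≢b b≢a =
  trans (cong (λ k → sign k 1ℚ) (NP.+-identityʳ (suc (toℕ a)))) (sign-suc (toℕ a) 1ℚ)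
sign-punchOut-anticomm {suc n} (suc a) (suc b) a≢b b≢a = begin
    sign (suc (toℕ a ℕ.+ suc (toℕ (punchOut a≢b′)))) 1ℚ
  ≡⟨ cong (λ k → sign (suc k) 1ℚ) (NP.+-suc (toℕ a) (toℕ (punchOut a≢b′))) ⟩
    sign (toℕ a ℕ.+ toℕ (punchOut a≢b′)) 1ℚ
  ≡⟨ sign-punchOut-anticomm a b a≢b′ b≢a′ ⟩
    - sign (toℕ b ℕ.+ toℕ (punchOut b≢a′)) 1ℚ
  ≡⟨ cong (λ k → - sign (suc k) 1ℚ) (sym (NP.+-suc (toℕ b) (toℕ (punchOut b≢a′)))) ⟩
    - sign (suc (toℕ b ℕ.+ suc (toℕ (punchOut b≢a′)))) 1ℚ ∎
  where
  open ≡-Reasoning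
  a≢b′ : a ≢ b
  a≢b′ = a≢b ∘ cong suc
  b≢a′ : b ≢ a
  b≢a′ = b≢a ∘ cong suc

sign-+-scalar : ∀ j k → sign (j ℕ.+ k) 1ℚ ≡ sign j 1ℚ * sign k 1ℚ
sign-+-scalar j k = trans (sign-+ j k 1ℚ) (sign-scalar j (sign k 1ℚ))

-- The minor of M without rows 0, 1 and columns a, b.
twoRowMinor : ∀ {n} → Mat (suc (suc n)) → (a b : Fin (suc (suc n))) → a ≢ b → ℚ
twoRowMinor M a b a≢b = det (λ x y → M (suc (suc x)) (punchIn a (punchIn (punchOut a≢b) y)))

-- Expanding det M along rows 0 and 1: the term using column a in row 0
-- and column b in row 1 (zero when a = b).
twoRowTerm : ∀ {n} → Mat (suc (suc n)) → Fin (suc (suc n)) → Fin (suc (suc n)) → ℚ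
twoRowTerm M a b with a ≟ b
... | yes _   = 0ℚ
... | no a≢b  = sign (toℕ a ℕ.+ toℕ (punchOut a≢b)) 1ℚ
                  * (M zero a * M (suc zero) b * twoRowMinor M a b a≢b)

twoRowTerm-diag : ∀ {n} (M : Mat (suc (suc n))) j → twoRowTerm M j j ≡ 0ℚ
twoRowTerm-diag M j with j ≟ j
... | yes _   = refl
... | no j≢j  = ⊥-elim (j≢j refl)

-- 'FP.punchOut-punchIn' for an arbitrary proof of the inequality.
punchOut-punchIn′ : ∀ {n} (j : Fin (suc n)) l (j≢jl : j ≢ punchIn j l) → punchOut j≢jl ≡ l
punchOut-punchIn′ j l _ = trans (FP.punchOut-cong j refl) (FP.punchOut-punchIn j)

twoRowTerm-punchIn : ∀ {n} (M : Mat (suc (suc n))) j l → twoRowTerm M j (punchIn j l) ≡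
  sign (toℕ j ℕ.+ toℕ l) 1ℚ * (M zero j * M (suc zero) (punchIn j l) * det (minor (minor M j) l))
twoRowTerm-punchIn M j l with j ≟ punchIn j l
... | yes e    = ⊥-elim (FP.punchInᵢ≢i j l (sym e))
... | no j≢jl  rewrite punchOut-punchIn′ j l j≢jl = refl

sign-*-Σ : ∀ {n} j (x : ℚ) (b d : Fin n → ℚ) (k : Fin n → ℕ) →
  sign j (x * Σℚ (λ l → sign (k l) (b l * d l))) ≡ Σℚ (λ l → sign (j ℕ.+ k l) 1ℚ * (x * b l * d l))
sign-*-Σ j x b d k = begin
    sign j (x * Σℚ (λ l → sign (k l) (b l * d l)))
  ≡⟨ trans (sign-scalar j (x * Σℚ (λ l → sign (k l) (b l * d l))))
           (sym (QP.*-assoc (sign j 1ℚ) x (Σℚ (λ l → sign (k l) (b l * d l))))) ⟩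
    sign j 1ℚ * x * Σℚ (λ l → sign (k l) (b l * d l))
  ≡⟨ sym (Σ-*ˡ (sign j 1ℚ * x) (λ l → sign (k l) (b l * d l))) ⟩
    Σℚ (λ l → sign j 1ℚ * x * sign (k l) (b l * d l))
  ≡⟨ Σ-cong (λ l → trans (cong (sign j 1ℚ * x *_) (sign-scalar (k l) (b l * d l)))
       (trans (regroup (sign j 1ℚ) (sign (k l) 1ℚ) x (b l) (d l))
              (cong (_* (x * b l * d l)) (sym (sign-+-scalar j (k l)))))) ⟩
    Σℚ (λ l → sign (j ℕ.+ k l) 1ℚ * (x * b l * d l)) ∎
  where
  open ≡-Reasoning
  regroup : ∀ s t x b d → s * x * (t * (b * d)) ≡ s * t * (x * b * d)
  regroup = solve-∀ ℚ-ring

det-twoRows : ∀ {n} (M : Mat (suc (suc n))) → det M ≡ Σℚ (λ a → Σℚ (λ b → twoRowTerm M a b))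
det-twoRows M = Σ-cong row
  where
  row : ∀ j → sign (toℕ j) (M zero j * det (minor M j)) ≡ Σℚ (twoRowTerm M j)
  row j = begin
      sign (toℕ j) (M zero j * det (minor M j))
    ≡⟨ sign-*-Σ (toℕ j) (M zero j) (λ l → M (suc zero) (punchIn j l))
                (λ l → det (minor (minor M j) l)) toℕ ⟩
      Σℚ (λ l → sign (toℕ j ℕ.+ toℕ l) 1ℚ
                  * (M zero j * M (suc zero) (punchIn j l) * det (minor (minor M j) l)))
    ≡⟨ Σ-cong (λ l → sym (twoRowTerm-punchIn M j l)) ⟩
      Σℚ (λ l → twoRowTerm M j (punchIn j l))
    ≡⟨ sym (trans (Σ-punchIn j (twoRowTerm M j))
                  (trans (cong (_+ Σℚ (λ l → twoRowTerm M j (punchIn j l))) (twoRowTerm-diag M j))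
                         (QP.+-identityˡ _))) ⟩
      Σℚ (twoRowTerm M j) ∎
    where open ≡-Reasoning

twoRowTerm-swap : ∀ {n} (M : Mat (suc (suc n))) a b →
                  twoRowTerm (permuteRows M (swapAdjacent zero)) a b ≡ - twoRowTerm M b a
twoRowTerm-swap M a b with a ≟ b | b ≟ a
... | yes _   | yes _   = sym (QP.neg-distrib-+ 0ℚ 0ℚ)
... | yes a≡b | no b≢a  = ⊥-elim (b≢a (sym a≡b))
... | no a≢b  | yes b≡a = ⊥-elim (a≢b (sym b≡a))
... | no a≢b  | no b≢a  =
  trans (cong₂ (λ s d → s * (M (suc zero) a * M zero b * d))
               (sign-punchOut-anticomm a b a≢b b≢a)
               (det-cong (λ x y → cong (M (suc (suc x))) (punchIn-punchOut-comm a b a≢b b≢a y))))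
        (rearrange (sign (toℕ b ℕ.+ toℕ (punchOut b≢a)) 1ℚ) (M (suc zero) a) (M zero b)
                   (twoRowMinor M b a b≢a))
  where
  rearrange : ∀ s x y d → (- s) * (x * y * d) ≡ - (s * (y * x * d))
  rearrange = solve-∀ ℚ-ring

det-swap₀₁ : ∀ {n} (M : Mat (suc (suc n))) → det (permuteRows M (swapAdjacent zero)) ≡ - det M
det-swap₀₁ M = begin
    det (permuteRows M (swapAdjacent zero))
  ≡⟨ det-twoRows (permuteRows M (swapAdjacent zero)) ⟩
    Σℚ (λ a → Σℚ (λ b → twoRowTerm (permuteRows M (swapAdjacent zero)) a b))
  ≡⟨ Σ-cong (λ a → trans (Σ-cong (twoRowTerm-swap M a)) (Σ-neg (λ b → twoRowTerm M b a))) ⟩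
    Σℚ (λ a → - Σℚ (λ b → twoRowTerm M b a))
  ≡⟨ Σ-neg (λ a → Σℚ (λ b → twoRowTerm M b a)) ⟩
    - Σℚ (λ a → Σℚ (λ b → twoRowTerm M b a))
  ≡⟨ cong -_ (trans (Σ-swap (λ a b → twoRowTerm M b a)) (sym (det-twoRows M))) ⟩
    - det M ∎
  where open ≡-Reasoning

-- Swapping two neighbouring rows negates the determinant; rows below 0
-- are handled by induction inside every minor.
det-swapAdjacent : ∀ {n} (u : Fin n) (M : Mat (suc n)) →
                   det (permuteRows M (swapAdjacent u)) ≡ - det M
det-swapAdjacent {suc n} zero    M = det-swap₀₁ M
det-swapAdjacent {suc n} (suc u) M = begin
    Σℚ (λ j → sign (toℕ j) (M zero j * det (permuteRows (minor M j) (swapAdjacent u))))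
  ≡⟨ Σ-cong (λ j → cong (λ z → sign (toℕ j) (M zero j * z)) (det-swapAdjacent u (minor M j))) ⟩
    Σℚ (λ j → sign (toℕ j) (M zero j * - det (minor M j)))
  ≡⟨ Σ-cong (λ j → trans (cong (sign (toℕ j)) (sym (QP.neg-distribʳ-* (M zero j) (det (minor M j)))))
                         (sign-neg (toℕ j) (M zero j * det (minor M j)))) ⟩
    Σℚ (λ j → - sign (toℕ j) (M zero j * det (minor M j)))
  ≡⟨ Σ-neg (λ j → sign (toℕ j) (M zero j * det (minor M j))) ⟩
    - det M ∎
  where open ≡-Reasoning

swapAdjacent-inject₁ : ∀ {n} (u : Fin n) → swapAdjacent u (inject₁ u) ≡ suc u
swapAdjacent-inject₁ zero    = refl
swapAdjacent-inject₁ (suc u) = cong suc (swapAdjacent-inject₁ u)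

swapAdjacent-below : ∀ {n} (u : Fin n) (x : Fin (suc n)) → toℕ x ℕ.< toℕ u → swapAdjacent u x ≡ x
swapAdjacent-below (suc u) zero    x<u       = refl
swapAdjacent-below (suc u) (suc x) (s≤s x<u) = cong suc (swapAdjacent-below u x x<u)

swapAdjacent-punchIn : ∀ {n} (u a : Fin n) →
                       swapAdjacent u (punchIn (inject₁ u) a) ≡ punchIn (suc u) a
swapAdjacent-punchIn zero    zero    = refl
swapAdjacent-punchIn zero    (suc a) = refl
swapAdjacent-punchIn (suc u) zero    = refl
swapAdjacent-punchIn (suc u) (suc a) = cong suc (swapAdjacent-punchIn u a)

swapAdjacent-invariant : ∀ {n} (u : Fin n) (h : Fin (suc n) → ℚ) →
                         h (inject₁ u) ≡ h (suc u) → ∀ x → h (swapAdjacent u x) ≡ h x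
swapAdjacent-invariant zero    h e zero          = sym e
swapAdjacent-invariant zero    h e (suc zero)    = e
swapAdjacent-invariant zero    h e (suc (suc x)) = refl
swapAdjacent-invariant (suc u) h e zero          = refl
swapAdjacent-invariant (suc u) h e (suc x)       = swapAdjacent-invariant u (h ∘ suc) e x

-- Equal neighbouring rows: swapping them fixes M but negates det M.
det-equalAdjacentRows : ∀ {n} (u : Fin n) (M : Mat (suc n)) →
                        (∀ c → M (inject₁ u) c ≡ M (suc u) c) → det M ≡ 0ℚ
det-equalAdjacentRows u M e = x≡-x⇒x≡0 (det M)
  (trans (sym (det-cong (λ x c → swapAdjacent-invariant u (λ y → M y c) (e c) x)))
         (det-swapAdjacent u M))

-- A matrix with two equal rows i < k has determinant zero: swap row k
-- upwards until it is adjacent to row i.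
det-equalRows : ∀ {n} (M : Mat (suc n)) (i k : Fin (suc n)) → toℕ i ℕ.< toℕ k →
                (∀ c → M i c ≡ M k c) → det M ≡ 0ℚ
det-equalRows M i k = go (toℕ k) M i k refl
  where
  go : ∀ d {n} (M : Mat (suc n)) (i k : Fin (suc n)) → toℕ k ≡ d → toℕ i ℕ.< toℕ k →
       (∀ c → M i c ≡ M k c) → det M ≡ 0ℚ
  go d       M i zero    _ () _
  go zero    M i (suc k) () _ _
  go (suc d) {suc n} M i (suc k) k≡d i<k rows with toℕ i ℕ.≟ toℕ k
  ... | yes i≡k = det-equalAdjacentRows k M (λ c → trans (cong (λ z → M z c) (sym i≡inject₁k)) (rows c))
    where
    i≡inject₁k : i ≡ inject₁ k
    i≡inject₁k = FP.toℕ-injective (trans i≡k (sym (FP.toℕ-inject₁ k)))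
  ... | no i≢k = begin
      det M                ≡⟨ sym (-‿involutive (det M)) ⟩
      - - det M            ≡⟨ cong -_ (sym (det-swapAdjacent k M)) ⟩
      - det M′             ≡⟨ cong -_ M′-singular ⟩
      - 0ℚ                 ≡⟨⟩
      0ℚ                   ∎
    where
    open ≡-Reasoning
    M′ : Mat (suc (suc n))
    M′ = permuteRows M (swapAdjacent k)
    i<k′ : toℕ i ℕ.< toℕ k
    i<k′ = NP.≤∧≢⇒< (NP.≤-pred i<k) i≢k
    M′-singular : det M′ ≡ 0ℚ
    M′-singular = go d M′ i (inject₁ k)
      (trans (FP.toℕ-inject₁ k) (NP.suc-injective k≡d))
      (subst (toℕ i ℕ.<_) (sym (FP.toℕ-inject₁ k)) i<k′)
      (λ c → trans (cong (λ z → M z c) (swapAdjacent-below k i i<k′))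
             (trans (rows c) (cong (λ z → M z c) (sym (swapAdjacent-inject₁ k)))))

delete : ∀ {n} → Mat (suc n) → Fin (suc n) → Fin (suc n) → Mat n
delete M u k a b = M (punchIn u a) (punchIn k b)

cofactor : ∀ {n} → Mat (suc n) → Fin (suc n) → Fin (suc n) → ℚ
cofactor M u k = sign (toℕ u ℕ.+ toℕ k) (det (delete M u k))

rowExpansion : ∀ {n} → Fin (suc n) → Mat (suc n) → ℚ
rowExpansion u M = Σℚ (λ k → sign (toℕ u ℕ.+ toℕ k) (M u k * det (delete M u k)))

-- The determinant can be expanded along any row: move row u to row u-1 by
-- an adjacent swap and use the expansion along row u-1.
det-rowExpansion : ∀ {n} (u : Fin (suc n)) (M : Mat (suc n)) → det M ≡ rowExpansion u M
det-rowExpansion u M = go (toℕ u) u M refl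
  where
  go : ∀ d {n} (u : Fin (suc n)) (M : Mat (suc n)) → toℕ u ≡ d → det M ≡ rowExpansion u M
  go d       zero    M u≡d = refl
  go zero    (suc u) M ()
  go (suc d) {suc n} (suc u) M u≡d = begin
      det M
    ≡⟨ sym (-‿involutive (det M)) ⟩
      - - det M
    ≡⟨ cong -_ (sym (det-swapAdjacent u M)) ⟩
      - det M′
    ≡⟨ cong -_ (go d (inject₁ u) M′ (trans (FP.toℕ-inject₁ u) (NP.suc-injective u≡d))) ⟩
      - rowExpansion (inject₁ u) M′
    ≡⟨ cong -_ (Σ-cong (λ k → cong₂ (λ s z → sign (s ℕ.+ toℕ k) z) (FP.toℕ-inject₁ u)
         (cong₂ _*_ (cong (λ z → M z k) (swapAdjacent-inject₁ u))
                    (det-cong (λ a b → cong (λ z → M z (punchIn k b)) (swapAdjacent-punchIn u a)))))) ⟩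
      - Σℚ (λ k → term k)
    ≡⟨ sym (Σ-neg term) ⟩
      Σℚ (λ k → - term k)
    ≡⟨ Σ-cong (λ k → sym (sign-suc (toℕ u ℕ.+ toℕ k) (M (suc u) k * det (delete M (suc u) k)))) ⟩
      rowExpansion (suc u) M ∎
    where
    open ≡-Reasoning
    M′ : Mat (suc (suc n))
    M′ = permuteRows M (swapAdjacent u)
    term : Fin (suc (suc n)) → ℚ
    term k = sign (toℕ u ℕ.+ toℕ k) (M (suc u) k * det (delete M (suc u) k))

-- The adjugate identity M · adj M = det M · I, entrywise: expanding row j
-- against the cofactors of row u gives det M when j = u, and otherwise the
-- determinant of M with row u replaced by row j, which has two equal rows.
adjugate-identity : ∀ {n} (M : Mat (suc n)) j u →
                    Σℚ (λ k → M j k * cofactor M u k) ≡ idM j u * det M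
adjugate-identity M j u = trans
  (Σ-cong (λ k → sym (sign-*ˡ (toℕ u ℕ.+ toℕ k) (M j k) (det (delete M u k)))))
  (expansion (j ≟ u))
  where
  expansion : Dec (j ≡ u) →
              Σℚ (λ k → sign (toℕ u ℕ.+ toℕ k) (M j k * det (delete M u k))) ≡ idM j u * det M
  expansion (yes refl) rewrite dec-true (j ≟ j) refl =
    trans (sym (det-rowExpansion j M)) (sym (QP.*-identityˡ (det M)))
  expansion (no j≢u) rewrite dec-false (j ≟ u) j≢u =
    trans (Σ-cong replaced-row)
          (trans (sym (det-rowExpansion u M′)) (trans M′-singular (sym (QP.*-zeroˡ (det M)))))
    where
    M′ : Mat _
    M′ a b = if does (a ≟ u) then M j b else M a b
    M′-row-u : ∀ c → M′ u c ≡ M j c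
    M′-row-u c rewrite dec-true (u ≟ u) refl = refl
    M′-other : ∀ a c → a ≢ u → M′ a c ≡ M a c
    M′-other a c a≢u rewrite dec-false (a ≟ u) a≢u = refl
    replaced-row : ∀ k → sign (toℕ u ℕ.+ toℕ k) (M j k * det (delete M u k))
                       ≡ sign (toℕ u ℕ.+ toℕ k) (M′ u k * det (delete M′ u k))
    replaced-row k = cong (sign (toℕ u ℕ.+ toℕ k)) (cong₂ _*_ (sym (M′-row-u k))
      (det-cong (λ a b → sym (M′-other (punchIn u a) (punchIn k b) (FP.punchInᵢ≢i u a)))))
    rows-j-u : ∀ c → M′ j c ≡ M′ u c
    rows-j-u c = trans (M′-other j c j≢u) (sym (M′-row-u c))
    M′-singular : det M′ ≡ 0ℚ
    M′-singular with NP.<-cmp (toℕ j) (toℕ u)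
    ... | tri< j<u _ _ = det-equalRows M′ j u j<u rows-j-u
    ... | tri≈ _ j≡u _ = ⊥-elim (j≢u (FP.toℕ-injective j≡u))
    ... | tri> _ _ u<j = det-equalRows M′ u j u<j (λ c → sym (rows-j-u c))

eval : Poly → ℚ → ℚ
eval []       t = 0ℚ
eval (c ∷ cs) t = c + t * eval cs t

eval-+P : ∀ p q t → eval (p +P q) t ≡ eval p t + eval q t
eval-+P []      q       t = sym (QP.+-identityˡ _)
eval-+P (a ∷ p) []      t = sym (QP.+-identityʳ _)
eval-+P (a ∷ p) (b ∷ q) t =
  trans (cong (λ z → (a + b) + t * z) (eval-+P p q t)) (regroup a b t (eval p t) (eval q t))
  where
  regroup : ∀ a b t x y → (a + b) + t * (x + y) ≡ (a + t * x) + (b + t * y)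
  regroup = solve-∀ ℚ-ring

eval-scaleP : ∀ c p t → eval (scaleP c p) t ≡ c * eval p t
eval-scaleP c []      t = sym (QP.*-zeroʳ c)
eval-scaleP c (a ∷ p) t =
  trans (cong (λ z → c * a + t * z) (eval-scaleP c p t)) (regroup c a t (eval p t))
  where
  regroup : ∀ c a t x → c * a + t * (c * x) ≡ c * (a + t * x)
  regroup = solve-∀ ℚ-ring

eval-*P : ∀ p q t → eval (p *P q) t ≡ eval p t * eval q t
eval-*P []      q t = sym (QP.*-zeroˡ (eval q t))
eval-*P (a ∷ p) q t = begin
    eval (scaleP a q +P (0ℚ ∷ (p *P q))) t
  ≡⟨ eval-+P (scaleP a q) (0ℚ ∷ (p *P q)) t ⟩
    eval (scaleP a q) t + (0ℚ + t * eval (p *P q) t)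
  ≡⟨ cong₂ (λ x y → x + (0ℚ + t * y)) (eval-scaleP a q t) (eval-*P p q t) ⟩
    a * eval q t + (0ℚ + t * (eval p t * eval q t))
  ≡⟨ regroup a t (eval q t) (eval p t) ⟩
    (a + t * eval p t) * eval q t ∎
  where
  open ≡-Reasoning
  regroup : ∀ a t y x → a * y + (0ℚ + t * (x * y)) ≡ (a + t * x) * y
  regroup = solve-∀ ℚ-ring

eval-signP : ∀ k p t → eval (signP k p) t ≡ sign k (eval p t)
eval-signP zero          p t = refl
eval-signP (suc zero)    p t = trans (eval-scaleP (- 1ℚ) p t) (-1*x≈-x (eval p t))
eval-signP (suc (suc k)) p t = eval-signP k p t

eval-ΣP : ∀ {n} (f : Fin n → Poly) t → eval (ΣP f) t ≡ Σℚ (λ i → eval (f i) t)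
eval-ΣP {zero}  f t = refl
eval-ΣP {suc n} f t =
  trans (eval-+P (f zero) (ΣP (f ∘ suc)) t) (cong (eval (f zero) t +_) (eval-ΣP (f ∘ suc) t))

eval-constP : ∀ c t → eval (constP c) t ≡ c
eval-constP c t = trans (cong (c +_) (QP.*-zeroʳ t)) (QP.+-identityʳ c)

eval-detP : ∀ {n} (M : Fin n → Fin n → Poly) t → eval (detP M) t ≡ det (λ i j → eval (M i j) t)
eval-detP {zero}  M t = eval-constP 1ℚ t
eval-detP {suc n} M t = trans (eval-ΣP term t) (Σ-cong (λ j →
  trans (eval-signP (toℕ j) (M zero j *P detP (minorP j)) t)
        (cong (sign (toℕ j)) (trans (eval-*P (M zero j) (detP (minorP j)) t)
                                    (cong (eval (M zero j) t *_) (eval-detP (minorP j) t))))))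
  where
  minorP : Fin (suc n) → Fin n → Fin n → Poly
  minorP j i k = M (suc i) (punchIn j k)
  term : Fin (suc n) → Poly
  term j = signP (toℕ j) (M zero j *P detP (minorP j))

coeff-+P : ∀ p q k → coeff (p +P q) k ≡ coeff p k + coeff q k
coeff-+P []      q       k       = sym (QP.+-identityˡ _)
coeff-+P (a ∷ p) []      zero    = sym (QP.+-identityʳ _)
coeff-+P (a ∷ p) []      (suc k) = sym (QP.+-identityʳ _)
coeff-+P (a ∷ p) (b ∷ q) zero    = refl
coeff-+P (a ∷ p) (b ∷ q) (suc k) = coeff-+P p q k

coeff-scaleP : ∀ c p k → coeff (scaleP c p) k ≡ c * coeff p k
coeff-scaleP c []      k       = sym (QP.*-zeroʳ c)
coeff-scaleP c (a ∷ p) zero    = refl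
coeff-scaleP c (a ∷ p) (suc k) = coeff-scaleP c p k

coeff-signP : ∀ s p k → coeff (signP s p) k ≡ sign s (coeff p k)
coeff-signP zero          p k = refl
coeff-signP (suc zero)    p k = trans (coeff-scaleP (- 1ℚ) p k) (-1*x≈-x (coeff p k))
coeff-signP (suc (suc s)) p k = coeff-signP s p k

coeff-ΣP : ∀ {n} (f : Fin n → Poly) k → coeff (ΣP f) k ≡ Σℚ (λ i → coeff (f i) k)
coeff-ΣP {zero}  f k = refl
coeff-ΣP {suc n} f k =
  trans (coeff-+P (f zero) (ΣP (f ∘ suc)) k) (cong (coeff (f zero) k +_) (coeff-ΣP (f ∘ suc) k))

shiftedCoeff : Poly → ℕ → ℚ
shiftedCoeff p zero    = 0ℚ
shiftedCoeff p (suc k) = coeff p k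

shiftedCoeff-[] : ∀ k → shiftedCoeff [] k ≡ 0ℚ
shiftedCoeff-[] zero    = refl
shiftedCoeff-[] (suc k) = refl

coeff-∷-*P : ∀ a p q k → coeff ((a ∷ p) *P q) k ≡ a * coeff q k + shiftedCoeff (p *P q) k
coeff-∷-*P a p q zero    =
  trans (coeff-+P (scaleP a q) _ zero) (cong (_+ 0ℚ) (coeff-scaleP a q zero))
coeff-∷-*P a p q (suc k) =
  trans (coeff-+P (scaleP a q) _ (suc k)) (cong (_+ coeff (p *P q) k) (coeff-scaleP a q (suc k)))

nat : ℕ → ℚ
nat zero    = 0ℚ
nat (suc k) = 1ℚ + nat k

nat-nonNeg : ∀ k → 0ℚ Q.≤ nat k
nat-nonNeg zero    = QP.≤-refl
nat-nonNeg (suc k) = QP.+-mono-≤ (toWitness {a? = 0ℚ QP.≤? 1ℚ} tt) (nat-nonNeg k)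

nat-suc≢0 : ∀ k → ¬ (nat (suc k) ≡ 0ℚ)
nat-suc≢0 k e = QP.<⇒≢ (QP.+-mono-<-≤ (toWitness {a? = 0ℚ QP.<? 1ℚ} tt) (nat-nonNeg k)) (sym e)

-- Synthetic division: the quotient of r by x - c (Horner's scheme).
syntheticDiv : ℚ → Poly → Poly
syntheticDiv c []          = []
syntheticDiv c (a ∷ [])    = []
syntheticDiv c (a ∷ b ∷ r) = eval (b ∷ r) c ∷ syntheticDiv c (b ∷ r)

syntheticDiv-length : ∀ c a r → length (syntheticDiv c (a ∷ r)) ≡ length r
syntheticDiv-length c a []      = refl
syntheticDiv-length c a (b ∷ r) = cong suc (syntheticDiv-length c b r)

syntheticDiv-eval : ∀ c r t → eval r t ≡ (t + - c) * eval (syntheticDiv c r) t + eval r c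
syntheticDiv-eval c []          t = regroup t c
  where
  regroup : ∀ t c → 0ℚ ≡ (t + - c) * 0ℚ + 0ℚ
  regroup = solve-∀ ℚ-ring
syntheticDiv-eval c (a ∷ [])    t = regroup a t c
  where
  regroup : ∀ a t c → a + t * 0ℚ ≡ (t + - c) * 0ℚ + (a + c * 0ℚ)
  regroup = solve-∀ ℚ-ring
syntheticDiv-eval c (a ∷ b ∷ r) t =
  trans (cong (λ z → a + t * z) (syntheticDiv-eval c (b ∷ r) t))
        (regroup a t c (eval (syntheticDiv c (b ∷ r)) t) (eval (b ∷ r) c))
  where
  regroup : ∀ a t c q ρ → a + t * ((t + - c) * q + ρ) ≡ (t + - c) * (ρ + t * q) + (a + c * ρ)
  regroup = solve-∀ ℚ-ring

syntheticDiv-coeff₀ : ∀ c r → coeff r zero ≡ (- c) * coeff (syntheticDiv c r) zero + eval r c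
syntheticDiv-coeff₀ c [] = regroup c
  where
  regroup : ∀ c → 0ℚ ≡ (- c) * 0ℚ + 0ℚ
  regroup = solve-∀ ℚ-ring
syntheticDiv-coeff₀ c (a ∷ []) = regroup a c
  where
  regroup : ∀ a c → a ≡ (- c) * 0ℚ + (a + c * 0ℚ)
  regroup = solve-∀ ℚ-ring
syntheticDiv-coeff₀ c (a ∷ b ∷ r) = regroup a c (eval (b ∷ r) c)
  where
  regroup : ∀ a c ρ → a ≡ (- c) * ρ + (a + c * ρ)
  regroup = solve-∀ ℚ-ring

syntheticDiv-coeffSuc : ∀ c r k → coeff r (suc k) ≡
  coeff (syntheticDiv c r) k + (- c) * coeff (syntheticDiv c r) (suc k)
syntheticDiv-coeffSuc c []          k = regroup c
  where
  regroup : ∀ c → 0ℚ ≡ 0ℚ + (- c) * 0ℚ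
  regroup = solve-∀ ℚ-ring
syntheticDiv-coeffSuc c (a ∷ [])    k = regroup c
  where
  regroup : ∀ c → 0ℚ ≡ 0ℚ + (- c) * 0ℚ
  regroup = solve-∀ ℚ-ring
syntheticDiv-coeffSuc c (a ∷ b ∷ r) zero    =
  trans (syntheticDiv-coeff₀ c (b ∷ r))
        (QP.+-comm ((- c) * coeff (syntheticDiv c (b ∷ r)) zero) (eval (b ∷ r) c))
syntheticDiv-coeffSuc c (a ∷ b ∷ r) (suc k) = syntheticDiv-coeffSuc c (b ∷ r) k

-- If r vanishes at c + s for every s ∈ ℕ, its quotient by x - c vanishes at
-- (c+1) + s: there r(t) = (t - c) q(t) with t - c = 1 + s ≠ 0.
syntheticDiv-roots : ∀ r c → (∀ s → eval r (c + nat s) ≡ 0ℚ) →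
                     ∀ s → eval (syntheticDiv c r) ((c + 1ℚ) + nat s) ≡ 0ℚ
syntheticDiv-roots r c root s = *-zero-cancelˡ (nat (suc s)) (eval q t) product (nat-suc≢0 s)
  where
  q : Poly
  q = syntheticDiv c r
  t : ℚ
  t = (c + 1ℚ) + nat s
  t-c : t + - c ≡ nat (suc s)
  t-c = shift c (nat s)
    where
    shift : ∀ c x → (c + 1ℚ) + x + - c ≡ 1ℚ + x
    shift = solve-∀ ℚ-ring
  root-c : eval r c ≡ 0ℚ
  root-c = trans (cong (eval r) (sym (QP.+-identityʳ c))) (root zero)
  product : nat (suc s) * eval q t ≡ 0ℚ
  product = begin
      nat (suc s) * eval q t
    ≡⟨ sym (trans (cong (λ x → x * eval q t + eval r c) t-c)
                  (trans (cong (nat (suc s) * eval q t +_) root-c) (QP.+-identityʳ _))) ⟩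
      (t + - c) * eval q t + eval r c
    ≡⟨ sym (syntheticDiv-eval c r t) ⟩
      eval r t
    ≡⟨ cong (eval r) (QP.+-assoc c 1ℚ (nat s)) ⟩
      eval r (c + nat (suc s))
    ≡⟨ root (suc s) ⟩
      0ℚ ∎
    where open ≡-Reasoning

zeroQuotient⇒zero : ∀ c r → eval r c ≡ 0ℚ → (∀ k → coeff (syntheticDiv c r) k ≡ 0ℚ) →
                    ∀ k → coeff r k ≡ 0ℚ
zeroQuotient⇒zero c r root q-zero zero = begin
    coeff r zero
  ≡⟨ syntheticDiv-coeff₀ c r ⟩
    (- c) * coeff (syntheticDiv c r) zero + eval r c
  ≡⟨ cong₂ (λ x y → (- c) * x + y) (q-zero zero) root ⟩
    (- c) * 0ℚ + 0ℚ
  ≡⟨ trans (QP.+-identityʳ _) (QP.*-zeroʳ (- c)) ⟩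
    0ℚ ∎
  where open ≡-Reasoning
zeroQuotient⇒zero c r root q-zero (suc k) = begin
    coeff r (suc k)
  ≡⟨ syntheticDiv-coeffSuc c r k ⟩
    coeff (syntheticDiv c r) k + (- c) * coeff (syntheticDiv c r) (suc k)
  ≡⟨ cong₂ (λ x y → x + (- c) * y) (q-zero k) (q-zero (suc k)) ⟩
    0ℚ + (- c) * 0ℚ
  ≡⟨ trans (QP.+-identityˡ _) (QP.*-zeroʳ (- c)) ⟩
    0ℚ ∎
  where open ≡-Reasoning

-- A polynomial vanishing at c, c+1, c+2, … is zero, by induction on its
-- length: its quotient by x - c vanishes at c+1, c+2, … and is shorter.
vanishing⇒zero : ∀ (r : Poly) c → (∀ s → eval r (c + nat s) ≡ 0ℚ) → ∀ k → coeff r k ≡ 0ℚ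
vanishing⇒zero r = go (length r) r NP.≤-refl
  where
  go : ∀ m (r : Poly) → length r ℕ.≤ m → ∀ c → (∀ s → eval r (c + nat s) ≡ 0ℚ) →
       ∀ k → coeff r k ≡ 0ℚ
  go m       []      _           c root k = refl
  go (suc m) (a ∷ r) (s≤s len≤m) c root =
    zeroQuotient⇒zero c (a ∷ r) (trans (cong (eval (a ∷ r)) (sym (QP.+-identityʳ c))) (root zero))
      (go m (syntheticDiv c (a ∷ r)) (subst (ℕ._≤ m) (sym (syntheticDiv-length c a r)) len≤m)
          (c + 1ℚ) (syntheticDiv-roots (a ∷ r) c root))

eval-injective : ∀ p q → (∀ t → eval p t ≡ eval q t) → p ≈P q
eval-injective p q same k = difference-zero (coeff p k) (coeff q k) (begin
    coeff p k + (- 1ℚ) * coeff q k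
  ≡⟨ cong (coeff p k +_) (sym (coeff-scaleP (- 1ℚ) q k)) ⟩
    coeff p k + coeff (-P q) k
  ≡⟨ sym (coeff-+P p (-P q) k) ⟩
    coeff (p +P (-P q)) k
  ≡⟨ vanishing⇒zero (p +P (-P q)) 0ℚ (λ s → difference-vanishes (0ℚ + nat s)) k ⟩
    0ℚ ∎)
  where
  open ≡-Reasoning
  difference-zero : ∀ a b → a + (- 1ℚ) * b ≡ 0ℚ → a ≡ b
  difference-zero a b e = trans (regroup a b) (trans (cong (_+ b) e) (QP.+-identityˡ b))
    where
    regroup : ∀ a b → a ≡ (a + (- 1ℚ) * b) + b
    regroup = solve-∀ ℚ-ring
  difference-vanishes : ∀ t → eval (p +P (-P q)) t ≡ 0ℚ
  difference-vanishes t = begin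
      eval (p +P (-P q)) t
    ≡⟨ trans (eval-+P p (-P q) t) (cong (eval p t +_) (eval-scaleP (- 1ℚ) q t)) ⟩
      eval p t + (- 1ℚ) * eval q t
    ≡⟨ cong (λ x → eval p t + (- 1ℚ) * x) (sym (same t)) ⟩
      eval p t + (- 1ℚ) * eval p t
    ≡⟨ cancel (eval p t) ⟩
      0ℚ ∎
    where
    cancel : ∀ x → x + (- 1ℚ) * x ≡ 0ℚ
    cancel = solve-∀ ℚ-ring

DegreeBelow : Poly → ℕ → Set
DegreeBelow p d = ∀ k → d ℕ.≤ k → coeff p k ≡ 0ℚ

degree-+P : ∀ {p q d} → DegreeBelow p d → DegreeBelow q d → DegreeBelow (p +P q) d
degree-+P {p} {q} hp hq k d≤k =
  trans (coeff-+P p q k) (trans (cong₂ _+_ (hp k d≤k) (hq k d≤k)) (QP.+-identityʳ 0ℚ))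

degree-signP : ∀ {p d} s → DegreeBelow p d → DegreeBelow (signP s p) d
degree-signP {p} s hp k d≤k = trans (coeff-signP s p k) (trans (cong (sign s) (hp k d≤k)) (sign-zero s))

degree-ΣP : ∀ {n d} (f : Fin n → Poly) → (∀ i → DegreeBelow (f i) d) → DegreeBelow (ΣP f) d
degree-ΣP {zero}  f hf k d≤k = refl
degree-ΣP {suc n} f hf = degree-+P {f zero} {ΣP (f ∘ suc)} (hf zero) (degree-ΣP (f ∘ suc) (hf ∘ suc))

-- The zero polynomial (in any representation) annihilates.
zero-*P : ∀ p q → DegreeBelow p 0 → DegreeBelow (p *P q) 0
zero-*P []      q hp k _ = refl
zero-*P (a ∷ p) q hp k _ = begin
    coeff ((a ∷ p) *P q) k                   ≡⟨ coeff-∷-*P a p q k ⟩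
    a * coeff q k + shiftedCoeff (p *P q) k  ≡⟨ cong₂ _+_ (cong (_* coeff q k) (hp 0 z≤n)) (tail-zero k) ⟩
    0ℚ * coeff q k + 0ℚ                      ≡⟨ trans (QP.+-identityʳ _) (QP.*-zeroˡ (coeff q k)) ⟩
    0ℚ                                       ∎
  where
  open ≡-Reasoning
  tail-zero : ∀ k → shiftedCoeff (p *P q) k ≡ 0ℚ
  tail-zero zero    = refl
  tail-zero (suc k) = zero-*P p q (λ j _ → hp (suc j) z≤n) k z≤n

degree-*P : ∀ p q d e → DegreeBelow p (suc d) → DegreeBelow q (suc e) →
            DegreeBelow (p *P q) (suc (d ℕ.+ e))
degree-*P []      q d e hp hq k _     = refl
degree-*P (a ∷ p) q d e hp hq k d+e<k = begin
    coeff ((a ∷ p) *P q) k                   ≡⟨ coeff-∷-*P a p q k ⟩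
    a * coeff q k + shiftedCoeff (p *P q) k  ≡⟨ cong₂ _+_ (cong (a *_) (hq k e<k))
                                                           (tail-zero d k d+e<k (λ j le → hp (suc j) (s≤s le))) ⟩
    a * 0ℚ + 0ℚ                              ≡⟨ trans (QP.+-identityʳ _) (QP.*-zeroʳ a) ⟩
    0ℚ                                       ∎
  where
  open ≡-Reasoning
  e<k : suc e ℕ.≤ k
  e<k = NP.≤-trans (s≤s (NP.m≤n+m e d)) d+e<k
  tail-zero : ∀ d k → suc (d ℕ.+ e) ℕ.≤ k → DegreeBelow p d → shiftedCoeff (p *P q) k ≡ 0ℚ
  tail-zero zero    (suc k) _        hp′ = zero-*P p q hp′ k z≤n
  tail-zero (suc d) (suc k) (s≤s le) hp′ = degree-*P p q d e hp′ hq k le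

charEntry : Bool → ℚ → Poly
charEntry b a = (if b then xP else []) +P (-P constP a)

charMatrix : ∀ {k} → (Fin k → Fin k → Bool) → Mat k → Fin k → Fin k → Poly
charMatrix B A i j = charEntry (B i j) (A i j)

charEntry-degree : ∀ b a → DegreeBelow (charEntry b a) 2
charEntry-degree true  a (suc (suc k)) (s≤s (s≤s _)) = refl
charEntry-degree false a (suc (suc k)) (s≤s (s≤s _)) = refl

charEntry-const : ∀ a → DegreeBelow (charEntry false a) 1
charEntry-const a (suc k) (s≤s _) = refl

detP-degree : ∀ {n} (M : Fin n → Fin n → Poly) → (∀ i j → DegreeBelow (M i j) 2) →
              DegreeBelow (detP M) (suc n)
detP-degree {zero}  M h (suc k) (s≤s _) = refl
detP-degree {suc n} M h = degree-ΣP term (λ j → degree-signP {M zero j *P detP (minorP j)} (toℕ j)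
  (degree-*P (M zero j) (detP (minorP j)) 1 n (h zero j)
             (detP-degree (minorP j) (λ i k → h (suc i) (punchIn j k)))))
  where
  minorP : Fin (suc n) → Fin n → Fin n → Poly
  minorP j i k = M (suc i) (punchIn j k)
  term : Fin (suc n) → Poly
  term j = signP (toℕ j) (M zero j *P detP (minorP j))

charEntry-leading : ∀ a D k → DegreeBelow D (suc k) → coeff D k ≡ 1ℚ →
                    coeff (charEntry true a *P D) (suc k) ≡ 1ℚ
charEntry-leading a D k hD lead = begin
    coeff (charEntry true a *P D) (suc k)
  ≡⟨ coeff-∷-*P (0ℚ + (- 1ℚ) * a) (1ℚ ∷ []) D (suc k) ⟩
    (0ℚ + (- 1ℚ) * a) * coeff D (suc k) + coeff ((1ℚ ∷ []) *P D) k
  ≡⟨ cong₂ (λ x y → (0ℚ + (- 1ℚ) * a) * x + y) (hD (suc k) NP.≤-refl)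
           (trans (coeff-∷-*P 1ℚ [] D k) (cong₂ (λ x y → 1ℚ * x + y) lead (shiftedCoeff-[] k))) ⟩
    (0ℚ + (- 1ℚ) * a) * 0ℚ + (1ℚ * 1ℚ + 0ℚ)
  ≡⟨ simplify a ⟩
    1ℚ ∎
  where
  open ≡-Reasoning
  simplify : ∀ a → (0ℚ + (- 1ℚ) * a) * 0ℚ + (1ℚ * 1ℚ + 0ℚ) ≡ 1ℚ
  simplify = solve-∀ ℚ-ring

charEntry-offDiagonal : ∀ a D k → DegreeBelow D (suc k) → coeff (charEntry false a *P D) (suc k) ≡ 0ℚ
charEntry-offDiagonal a D k hD = degree-*P (charEntry false a) D 0 k (charEntry-const a) hD (suc k) NP.≤-refl

-- det(xB - A) is monic of degree k when B is the identity pattern: along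
-- row 0 only the diagonal term reaches degree k.
charMatrix-monic : ∀ {k} (B : Fin k → Fin k → Bool) (A : Mat k) →
  (∀ i → B i i ≡ true) → (∀ i j → i ≢ j → B i j ≡ false) → coeff (detP (charMatrix B A)) k ≡ 1ℚ
charMatrix-monic {zero}  B A diag off = refl
charMatrix-monic {suc k} B A diag off = begin
    coeff (detP (charMatrix B A)) (suc k)
  ≡⟨ coeff-ΣP (λ j → signP (toℕ j) (charMatrix B A zero j *P minorP j)) (suc k) ⟩
    coeff (charMatrix B A zero zero *P minorP zero) (suc k)
      + Σℚ (λ j → coeff (signP (toℕ (suc j)) (charMatrix B A zero (suc j) *P minorP (suc j))) (suc k))
  ≡⟨ cong₂ _+_ diagonal-term (trans (Σ-cong other-term) (Σ-zero {k})) ⟩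
    1ℚ + 0ℚ
  ≡⟨ QP.+-identityʳ 1ℚ ⟩
    1ℚ ∎
  where
  open ≡-Reasoning
  minorP : Fin (suc k) → Poly
  minorP j = detP (λ i l → charMatrix B A (suc i) (punchIn j l))
  minorP-degree : ∀ j → DegreeBelow (minorP j) (suc k)
  minorP-degree j = detP-degree _ (λ i l → charEntry-degree (B (suc i) (punchIn j l)) (A (suc i) (punchIn j l)))
  diagonal-term : coeff (charMatrix B A zero zero *P minorP zero) (suc k) ≡ 1ℚ
  diagonal-term rewrite diag zero = charEntry-leading (A zero zero) (minorP zero) k (minorP-degree zero)
    (charMatrix-monic (λ i l → B (suc i) (suc l)) (λ i l → A (suc i) (suc l))
                      (λ i → diag (suc i)) (λ i l i≢l → off (suc i) (suc l) (i≢l ∘ FP.suc-injective)))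
  other-term : ∀ j → coeff (signP (toℕ (suc j)) (charMatrix B A zero (suc j) *P minorP (suc j))) (suc k) ≡ 0ℚ
  other-term j rewrite coeff-signP (toℕ (suc j)) (charMatrix B A zero (suc j) *P minorP (suc j)) (suc k)
                     | off zero (suc j) (λ ())
    = trans (cong (sign (toℕ (suc j)))
                  (charEntry-offDiagonal (A zero (suc j)) (minorP (suc j)) k (minorP-degree (suc j))))
            (sign-zero (toℕ (suc j)))

Σ< : ℕ → (ℕ → ℚ) → ℚ
Σ< zero    f = 0ℚ
Σ< (suc e) f = f 0 + Σ< e (f ∘ suc)

Σ<-cong : ∀ e {f g : ℕ → ℚ} → (∀ i → i ℕ.< e → f i ≡ g i) → Σ< e f ≡ Σ< e g
Σ<-cong zero    h = refl
Σ<-cong (suc e) h = cong₂ _+_ (h 0 (s≤s z≤n)) (Σ<-cong e (λ i i<e → h (suc i) (s≤s i<e)))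

Σ<-last : ∀ e f → Σ< (suc e) f ≡ Σ< e f + f e
Σ<-last zero    f = trans (QP.+-identityʳ (f 0)) (sym (QP.+-identityˡ (f 0)))
Σ<-last (suc e) f = trans (cong (f 0 +_) (Σ<-last e (f ∘ suc))) (sym (QP.+-assoc (f 0) _ _))

Σ<-neg : ∀ e f → Σ< e (λ i → - f i) ≡ - Σ< e f
Σ<-neg zero    f = refl
Σ<-neg (suc e) f = trans (cong ((- f 0) +_) (Σ<-neg e (f ∘ suc))) (sym (QP.neg-distrib-+ (f 0) _))

Σ-Σ< : ∀ {n} e (c : Fin n → ℚ) (g : Fin n → ℕ → ℚ) →
       Σℚ (λ k → c k * Σ< e (g k)) ≡ Σ< e (λ i → Σℚ (λ k → c k * g k i))
Σ-Σ< {n} zero    c g = trans (Σ-cong (λ k → QP.*-zeroʳ (c k))) (Σ-zero {n})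
Σ-Σ<     (suc e) c g = begin
    Σℚ (λ k → c k * (g k 0 + Σ< e (g k ∘ suc)))
  ≡⟨ Σ-cong (λ k → QP.*-distribˡ-+ (c k) (g k 0) (Σ< e (g k ∘ suc))) ⟩
    Σℚ (λ k → c k * g k 0 + c k * Σ< e (g k ∘ suc))
  ≡⟨ Σ-+ (λ k → c k * g k 0) (λ k → c k * Σ< e (g k ∘ suc)) ⟩
    Σℚ (λ k → c k * g k 0) + Σℚ (λ k → c k * Σ< e (g k ∘ suc))
  ≡⟨ cong (Σℚ (λ k → c k * g k 0) +_) (Σ-Σ< e c (λ k → g k ∘ suc)) ⟩
    Σℚ (λ k → c k * g k 0) + Σ< e (λ i → Σℚ (λ k → c k * g k (suc i))) ∎
  where open ≡-Reasoning

indicator : Bool → ℚ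
indicator b = if b then 1ℚ else 0ℚ

coeff-charEntry-*P : ∀ b a p d →
  coeff (charEntry b a *P p) d ≡ indicator b * shiftedCoeff p d + (- a) * coeff p d
coeff-charEntry-*P true a p zero =
  trans (coeff-∷-*P (0ℚ + (- 1ℚ) * a) (1ℚ ∷ []) p zero) (regroup a (coeff p zero))
  where
  regroup : ∀ a x → (0ℚ + (- 1ℚ) * a) * x + 0ℚ ≡ 1ℚ * 0ℚ + (- a) * x
  regroup = solve-∀ ℚ-ring
coeff-charEntry-*P true a p (suc d) = begin
    coeff (charEntry true a *P p) (suc d)
  ≡⟨ coeff-∷-*P (0ℚ + (- 1ℚ) * a) (1ℚ ∷ []) p (suc d) ⟩
    (0ℚ + (- 1ℚ) * a) * coeff p (suc d) + coeff ((1ℚ ∷ []) *P p) d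
  ≡⟨ cong ((0ℚ + (- 1ℚ) * a) * coeff p (suc d) +_) (coeff-∷-*P 1ℚ [] p d) ⟩
    (0ℚ + (- 1ℚ) * a) * coeff p (suc d) + (1ℚ * coeff p d + shiftedCoeff [] d)
  ≡⟨ cong (λ z → (0ℚ + (- 1ℚ) * a) * coeff p (suc d) + (1ℚ * coeff p d + z)) (shiftedCoeff-[] d) ⟩
    (0ℚ + (- 1ℚ) * a) * coeff p (suc d) + (1ℚ * coeff p d + 0ℚ)
  ≡⟨ regroup a (coeff p (suc d)) (coeff p d) ⟩
    1ℚ * coeff p d + (- a) * coeff p (suc d) ∎
  where
  open ≡-Reasoning
  regroup : ∀ a x y → (0ℚ + (- 1ℚ) * a) * x + (1ℚ * y + 0ℚ) ≡ 1ℚ * y + (- a) * x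
  regroup = solve-∀ ℚ-ring
coeff-charEntry-*P false a p d = trans (coeff-∷-*P ((- 1ℚ) * a) [] p d)
  (trans (cong ((- 1ℚ) * a * coeff p d +_) (shiftedCoeff-[] d)) (regroup a (coeff p d) (shiftedCoeff p d)))
  where
  regroup : ∀ a x y → (- 1ℚ) * a * x + 0ℚ ≡ 0ℚ * y + (- a) * x
  regroup = solve-∀ ℚ-ring

-- Let φ(x) = det(xI - A) = Σ_d a_d x^d and let N_k(x) be the (u,k) cofactor
-- of xI - A.  The adjugate identity Σ_k (xI - A)_jk N_k = [j = u] φ, read
-- coefficientwise, is a recursion for the coefficients ν_d of N which, since
-- deg N < n, solves to  ν_d(j) = Σ_{i < n-d} a_(d+1+i) (A^i)_ju.  In degree 0
-- it gives the u-th column of the Cayley–Hamilton identity φ(A) = 0.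
module CharMatrixCofactors {m : ℕ} (A : Mat (suc m)) where

  n : ℕ
  n = suc m

  xI-A : Fin n → Fin n → Poly
  xI-A = charMatrix (λ i j → does (i ≟ j)) A

  a : ℕ → ℚ
  a d = coeff (charPoly A) d

  charPoly-monic : a n ≡ 1ℚ
  charPoly-monic = charMatrix-monic (λ i j → does (i ≟ j)) A
                                    (λ i → dec-true (i ≟ i) refl) (λ i j → dec-false (i ≟ j))

  Σ-negA : ∀ j (y : Fin n → ℚ) → Σℚ (λ k → (- A j k) * y k) ≡ - Σℚ (λ k → A j k * y k)
  Σ-negA j y = trans (Σ-cong (λ k → sym (QP.neg-distribˡ-* (A j k) (y k)))) (Σ-neg (λ k → A j k * y k))

  module _ (u : Fin n) where

    N : Fin n → Poly
    N k = signP (toℕ u ℕ.+ toℕ k) (detP (λ x y → xI-A (punchIn u x) (punchIn k y)))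

    ν : ℕ → Fin n → ℚ
    ν d k = coeff (N k) d

    N-eval : ∀ k t → eval (N k) t ≡ cofactor (λ i j → eval (xI-A i j) t) u k
    N-eval k t = trans (eval-signP (toℕ u ℕ.+ toℕ k) _ t)
      (cong (sign (toℕ u ℕ.+ toℕ k)) (eval-detP (λ x y → xI-A (punchIn u x) (punchIn k y)) t))

    -- The adjugate identity holds at every point, hence as polynomials.
    adjugate-identityP : ∀ j → ΣP (λ k → xI-A j k *P N k) ≈P scaleP (idM j u) (charPoly A)
    adjugate-identityP j =
      eval-injective (ΣP (λ k → xI-A j k *P N k)) (scaleP (idM j u) (charPoly A)) (λ t → begin
        eval (ΣP (λ k → xI-A j k *P N k)) t
      ≡⟨ eval-ΣP (λ k → xI-A j k *P N k) t ⟩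
        Σℚ (λ k → eval (xI-A j k *P N k) t)
      ≡⟨ Σ-cong (λ k → trans (eval-*P (xI-A j k) (N k) t) (cong (eval (xI-A j k) t *_) (N-eval k t))) ⟩
        Σℚ (λ k → eval (xI-A j k) t * cofactor (λ i l → eval (xI-A i l) t) u k)
      ≡⟨ adjugate-identity (λ i l → eval (xI-A i l) t) j u ⟩
        idM j u * det (λ i l → eval (xI-A i l) t)
      ≡⟨ cong (idM j u *_) (sym (eval-detP xI-A t)) ⟩
        idM j u * eval (charPoly A) t
      ≡⟨ sym (eval-scaleP (idM j u) (charPoly A) t) ⟩
        eval (scaleP (idM j u) (charPoly A)) t ∎)
      where open ≡-Reasoning

    adjugate-coeff : ∀ d j → shiftedCoeff (N j) d + Σℚ (λ k → (- A j k) * ν d k) ≡ idM j u * a d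
    adjugate-coeff d j = begin
        shiftedCoeff (N j) d + Σℚ (λ k → (- A j k) * ν d k)
      ≡⟨ cong (_+ Σℚ (λ k → (- A j k) * ν d k)) (sym (Σ-idMˡ j (λ k → shiftedCoeff (N k) d))) ⟩
        Σℚ (λ k → idM j k * shiftedCoeff (N k) d) + Σℚ (λ k → (- A j k) * ν d k)
      ≡⟨ sym (Σ-+ (λ k → idM j k * shiftedCoeff (N k) d) (λ k → (- A j k) * ν d k)) ⟩
        Σℚ (λ k → idM j k * shiftedCoeff (N k) d + (- A j k) * ν d k)
      ≡⟨ Σ-cong (λ k → sym (coeff-charEntry-*P (does (j ≟ k)) (A j k) (N k) d)) ⟩
        Σℚ (λ k → coeff (xI-A j k *P N k) d)
      ≡⟨ sym (coeff-ΣP (λ k → xI-A j k *P N k) d) ⟩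
        coeff (ΣP (λ k → xI-A j k *P N k)) d
      ≡⟨ trans (adjugate-identityP j d) (coeff-scaleP (idM j u) (charPoly A) d) ⟩
        idM j u * a d ∎
      where open ≡-Reasoning

    ν-recurrence : ∀ d j → ν d j ≡ idM j u * a (suc d) + Σℚ (λ k → A j k * ν (suc d) k)
    ν-recurrence d j = move (ν d j) _ _
      (trans (cong (ν d j +_) (sym (Σ-negA j (ν (suc d))))) (adjugate-coeff (suc d) j))
      where
      move : ∀ x S c → x + - S ≡ c → x ≡ c + S
      move x S c e = trans (regroup x S) (cong (_+ S) e)
        where
        regroup : ∀ x S → x ≡ (x + - S) + S
        regroup = solve-∀ ℚ-ring

    ν-degree : ∀ d k → n ℕ.≤ d → ν d k ≡ 0ℚ
    ν-degree d k n≤d = degree-signP {detP (λ x y → xI-A (punchIn u x) (punchIn k y))} (toℕ u ℕ.+ toℕ k)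
      (detP-degree _ (λ x y → charEntry-degree (does (punchIn u x ≟ punchIn k y))
                                                (A (punchIn u x) (punchIn k y))))
      d n≤d

    -- Solving the recursion downwards from degree n.
    ν-walks : ∀ e d → d ℕ.+ e ≡ n → ∀ j → ν d j ≡ Σ< e (λ i → a (suc (d ℕ.+ i)) * (A ^M i) j u)
    ν-walks zero     d d+0≡n j = ν-degree d j (NP.≤-reflexive (trans (sym d+0≡n) (NP.+-identityʳ d)))
    ν-walks (suc e) d d+e≡n j = begin
        ν d j
      ≡⟨ ν-recurrence d j ⟩
        idM j u * a (suc d) + Σℚ (λ k → A j k * ν (suc d) k)
      ≡⟨ cong (idM j u * a (suc d) +_)
              (Σ-cong (λ k → cong (A j k *_) (ν-walks e (suc d) (trans (sym (NP.+-suc d e)) d+e≡n) k))) ⟩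
        idM j u * a (suc d) + Σℚ (λ k → A j k * Σ< e (λ i → a (suc (suc d ℕ.+ i)) * (A ^M i) k u))
      ≡⟨ cong (idM j u * a (suc d) +_) (Σ-Σ< e (λ k → A j k) (λ k i → a (suc (suc d ℕ.+ i)) * (A ^M i) k u)) ⟩
        idM j u * a (suc d) + Σ< e (λ i → Σℚ (λ k → A j k * (a (suc (suc d ℕ.+ i)) * (A ^M i) k u)))
      ≡⟨ cong₂ _+_ first-term (Σ<-cong e (λ i _ → later-term i)) ⟩
        Σ< (suc e) (λ i → a (suc (d ℕ.+ i)) * (A ^M i) j u) ∎
      where
      open ≡-Reasoning
      first-term : idM j u * a (suc d) ≡ a (suc (d ℕ.+ 0)) * idM j u
      first-term = trans (QP.*-comm (idM j u) (a (suc d)))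
                         (cong (λ z → a (suc z) * idM j u) (sym (NP.+-identityʳ d)))
      later-term : ∀ i → Σℚ (λ k → A j k * (a (suc (suc d ℕ.+ i)) * (A ^M i) k u))
                         ≡ a (suc (d ℕ.+ suc i)) * (A ^M suc i) j u
      later-term i = trans (Σ-cong (λ k → swap (A j k) (a (suc (suc d ℕ.+ i))) ((A ^M i) k u)))
        (trans (Σ-*ˡ (a (suc (suc d ℕ.+ i))) (λ k → A j k * (A ^M i) k u))
               (cong (λ z → a (suc z) * (A ^M suc i) j u) (sym (NP.+-suc d i))))
        where
        swap : ∀ x y z → x * (y * z) ≡ y * (x * z)
        swap = solve-∀ ℚ-ring

    cayleyHamilton-column : ∀ j → Σ< (suc n) (λ i → a i * (A ^M i) j u) ≡ 0ℚ
    cayleyHamilton-column j = trans (cong (_+ S) (trans (QP.*-comm (a 0) (idM j u)) (sym degree-0)))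
                                    (QP.+-inverseˡ S)
      where
      S : ℚ
      S = Σ< n (λ i → a (suc i) * (A ^M suc i) j u)
      degree-0 : - S ≡ idM j u * a 0
      degree-0 = begin
          - S
        ≡⟨ sym (Σ<-neg n (λ i → a (suc i) * (A ^M suc i) j u)) ⟩
          Σ< n (λ i → - (a (suc i) * (A ^M suc i) j u))
        ≡⟨ Σ<-cong n (λ i _ → trans (cong -_ (sym (Σ-*ˡ (a (suc i)) (λ k → A j k * (A ^M i) k u))))
              (trans (sym (Σ-neg (λ k → a (suc i) * (A j k * (A ^M i) k u))))
                     (Σ-cong (λ k → regroup (A j k) (a (suc i)) ((A ^M i) k u))))) ⟩
          Σ< n (λ i → Σℚ (λ k → (- A j k) * (a (suc i) * (A ^M i) k u)))
        ≡⟨ sym (Σ-Σ< n (λ k → - A j k) (λ k i → a (suc i) * (A ^M i) k u)) ⟩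
          Σℚ (λ k → (- A j k) * Σ< n (λ i → a (suc i) * (A ^M i) k u))
        ≡⟨ Σ-cong (λ k → cong ((- A j k) *_) (sym (ν-walks n 0 refl k))) ⟩
          Σℚ (λ k → (- A j k) * ν 0 k)
        ≡⟨ trans (sym (QP.+-identityˡ _)) (adjugate-coeff 0 j) ⟩
          idM j u * a 0 ∎
        where
        open ≡-Reasoning
        regroup : ∀ x y z → - (y * (x * z)) ≡ (- x) * (y * z)
        regroup = solve-∀ ℚ-ring

-- (A^k)_zz: for an adjacency matrix, the number of closed walks of length k at z.
closedWalks : ∀ {n} → Mat n → Fin n → ℕ → ℚ
closedWalks A z k = (A ^M k) z z

SameClosedWalks : ∀ {n} → Mat n → Fin n → Fin n → Set
SameClosedWalks A u v = ∀ k → closedWalks A u k ≡ closedWalks A v k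

-- Cayley–Hamilton makes the closed walk counts at z a linear recurrence of order n.
module ClosedWalkRecurrence {m : ℕ} (A : Mat (suc m)) where

  open CharMatrixCofactors A using (n; a; charPoly-monic; cayleyHamilton-column)

  -- (A^t φ(A))_zz = 0.
  closedWalks-annihilated : ∀ z t → Σ< (suc n) (λ i → a i * closedWalks A z (t ℕ.+ i)) ≡ 0ℚ
  closedWalks-annihilated z t = sym (begin
      0ℚ
    ≡⟨ sym (trans (Σ-cong (λ j → trans (cong ((A ^M t) z j *_) (cayleyHamilton-column z j))
                                         (QP.*-zeroʳ ((A ^M t) z j))))
                  (Σ-zero {n})) ⟩
      Σℚ (λ j → (A ^M t) z j * Σ< (suc n) (λ i → a i * (A ^M i) j z))
    ≡⟨ Σ-Σ< (suc n) (λ j → (A ^M t) z j) (λ j i → a i * (A ^M i) j z) ⟩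
      Σ< (suc n) (λ i → Σℚ (λ j → (A ^M t) z j * (a i * (A ^M i) j z)))
    ≡⟨ Σ<-cong (suc n) (λ i _ → trans (Σ-cong (λ j → swap ((A ^M t) z j) (a i) ((A ^M i) j z)))
         (trans (Σ-*ˡ (a i) (λ j → (A ^M t) z j * (A ^M i) j z)) (cong (a i *_) (sym (^M-+ A t i z z))))) ⟩
      Σ< (suc n) (λ i → a i * closedWalks A z (t ℕ.+ i)) ∎)
    where
    open ≡-Reasoning
    swap : ∀ x y z → x * (y * z) ≡ y * (x * z)
    swap = solve-∀ ℚ-ring

  -- As φ is monic of degree n, w(t+n) is determined by w(t), …, w(t+n-1).
  closedWalks-recurrence : ∀ z t →
    closedWalks A z (t ℕ.+ n) ≡ - Σ< n (λ i → a i * closedWalks A z (t ℕ.+ i))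
  closedWalks-recurrence z t = solve-for (Σ< n (λ i → a i * closedWalks A z (t ℕ.+ i))) (closedWalks A z (t ℕ.+ n))
    (begin
      Σ< n (λ i → a i * closedWalks A z (t ℕ.+ i)) + closedWalks A z (t ℕ.+ n)
    ≡⟨ cong (Σ< n (λ i → a i * closedWalks A z (t ℕ.+ i)) +_)
            (trans (sym (QP.*-identityˡ _)) (cong (_* closedWalks A z (t ℕ.+ n)) (sym charPoly-monic))) ⟩
      Σ< n (λ i → a i * closedWalks A z (t ℕ.+ i)) + a n * closedWalks A z (t ℕ.+ n)
    ≡⟨ sym (Σ<-last n (λ i → a i * closedWalks A z (t ℕ.+ i))) ⟩
      Σ< (suc n) (λ i → a i * closedWalks A z (t ℕ.+ i))
    ≡⟨ closedWalks-annihilated z t ⟩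
      0ℚ ∎)
    where
    open ≡-Reasoning
    solve-for : ∀ x y → x + y ≡ 0ℚ → y ≡ - x
    solve-for x y e = trans (regroup x y) (trans (cong (_+ - x) e) (QP.+-identityˡ (- x)))
      where
      regroup : ∀ x y → y ≡ (x + y) + - x
      regroup = solve-∀ ℚ-ring

  sameClosedWalks-fromInitial : ∀ u v → (∀ k → k ℕ.< n → closedWalks A u k ≡ closedWalks A v k) →
                                SameClosedWalks A u v
  sameClosedWalks-fromInitial u v initial = <-rec _ step
    where
    step : ∀ k → (∀ {i} → i ℕ.< k → closedWalks A u i ≡ closedWalks A v i) →
           closedWalks A u k ≡ closedWalks A v k
    step k earlier with k ℕ.<? n
    ... | yes k<n = initial k k<n
    ... | no  k≮n = subst (λ l → closedWalks A u l ≡ closedWalks A v l) t+n≡k (begin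
        closedWalks A u (t ℕ.+ n)
      ≡⟨ closedWalks-recurrence u t ⟩
        - Σ< n (λ i → a i * closedWalks A u (t ℕ.+ i))
      ≡⟨ cong -_ (Σ<-cong n (λ i i<n → cong (a i *_) (earlier (t+i<k i<n)))) ⟩
        - Σ< n (λ i → a i * closedWalks A v (t ℕ.+ i))
      ≡⟨ sym (closedWalks-recurrence v t) ⟩
        closedWalks A v (t ℕ.+ n) ∎)
      where
      open ≡-Reasoning
      t : ℕ
      t = k ∸ n
      t+n≡k : t ℕ.+ n ≡ k
      t+n≡k = NP.m∸n+n≡m (NP.≮⇒≥ k≮n)
      t+i<k : ∀ {i} → i ℕ.< n → t ℕ.+ i ℕ.< k
      t+i<k i<n = subst (t ℕ.+ _ ℕ.<_) t+n≡k (NP.+-monoʳ-< t i<n)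

-- A with row and column z removed; for an adjacency matrix, that of X \ z.
principalSubmatrix : ∀ {m} → Mat (suc m) → Fin (suc m) → Mat m
principalSubmatrix A z i j = A (punchIn z i) (punchIn z j)

detP-cong : ∀ {n} {M N : Fin n → Fin n → Poly} → (∀ i j → M i j ≡ N i j) → detP M ≡ detP N
detP-cong {zero}  e = refl
detP-cong {suc n} e = ΣP-cong (λ j → cong (signP (toℕ j))
  (cong₂ _*P_ (e zero j) (detP-cong (λ a b → e (suc a) (punchIn j b)))))
  where
  ΣP-cong : ∀ {n} {f g : Fin n → Poly} → (∀ i → f i ≡ g i) → ΣP f ≡ ΣP g
  ΣP-cong {zero}  e = refl
  ΣP-cong {suc n} e = cong₂ _+P_ (e zero) (ΣP-cong (e ∘ suc))

-- punchIn z is injective, so it preserves the answer of ≟ (the identity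
-- pattern of xI - A restricts to that of the principal submatrix).
punchIn-≟ : ∀ {n} (z : Fin (suc n)) x y → does (punchIn z x ≟ punchIn z y) ≡ does (x ≟ y)
punchIn-≟ z x y with x ≟ y
... | yes refl = dec-true (punchIn z x ≟ punchIn z x) refl
... | no  x≢y  = dec-false (punchIn z x ≟ punchIn z y) (x≢y ∘ FP.punchIn-injective z x y)

module DeletedCharPoly {m : ℕ} (A : Mat (suc m)) where

  open CharMatrixCofactors A using (n; a; ν; ν-walks; ν-degree; charPoly-monic)
  open ClosedWalkRecurrence A using (sameClosedWalks-fromInitial)

  -- The (z,z) cofactor of xI - A is the characteristic polynomial of the
  -- principal submatrix at z (the sign (-1)^(z+z) is +1).
  diagonalCofactor : ∀ z d → ν z d z ≡ coeff (charPoly (principalSubmatrix A z)) d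
  diagonalCofactor z d = trans (coeff-signP (toℕ z ℕ.+ toℕ z) _ d)
    (trans (sign-double (toℕ z) _)
           (cong (λ p → coeff p d) (detP-cong (λ x y →
              cong (λ b → charEntry b (A (punchIn z x) (punchIn z y))) (punchIn-≟ z x y)))))

  deletedCharPoly-walks : ∀ z e d → d ℕ.+ e ≡ n →
    coeff (charPoly (principalSubmatrix A z)) d ≡ Σ< e (λ i → a (suc (d ℕ.+ i)) * closedWalks A z i)
  deletedCharPoly-walks z e d d+e≡n = trans (sym (diagonalCofactor z d)) (ν-walks z e d d+e≡n z)

  -- For an adjacency matrix this is 'Cospectral'.
  Cospectral′ : Fin n → Fin n → Set
  Cospectral′ u v = charPoly (principalSubmatrix A u) ≈P charPoly (principalSubmatrix A v)

  -- Same closed walk counts give the same deleted characteristic polynomials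
  -- (coefficients of degree > n-1 vanish on both sides).
  sameClosedWalks⇒cospectral : ∀ u v → SameClosedWalks A u v → Cospectral′ u v
  sameClosedWalks⇒cospectral u v same d with d ℕ.≤? n
  ... | yes d≤n = begin
      coeff (charPoly (principalSubmatrix A u)) d
    ≡⟨ deletedCharPoly-walks u (n ∸ d) d (NP.m+[n∸m]≡n d≤n) ⟩
      Σ< (n ∸ d) (λ i → a (suc (d ℕ.+ i)) * closedWalks A u i)
    ≡⟨ Σ<-cong (n ∸ d) (λ i _ → cong (a (suc (d ℕ.+ i)) *_) (same i)) ⟩
      Σ< (n ∸ d) (λ i → a (suc (d ℕ.+ i)) * closedWalks A v i)
    ≡⟨ sym (deletedCharPoly-walks v (n ∸ d) d (NP.m+[n∸m]≡n d≤n)) ⟩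
      coeff (charPoly (principalSubmatrix A v)) d ∎
    where open ≡-Reasoning
  ... | no d≰n = begin
      coeff (charPoly (principalSubmatrix A u)) d  ≡⟨ sym (diagonalCofactor u d) ⟩
      ν u d u                                      ≡⟨ ν-degree u d u n≤d ⟩
      0ℚ                                           ≡⟨ sym (ν-degree v d v n≤d) ⟩
      ν v d v                                      ≡⟨ diagonalCofactor v d ⟩
      coeff (charPoly (principalSubmatrix A v)) d  ∎
    where
    open ≡-Reasoning
    n≤d : n ℕ.≤ d
    n≤d = NP.<⇒≤ (NP.≰⇒> d≰n)

  -- Conversely, the relations for d = n-1, n-2, … form a triangular system
  -- with unit diagonal (a_n = 1) in the closed walk counts of lengths 0, 1, ….
  cospectral⇒initialClosedWalks : ∀ u v → Cospectral′ u v →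
    ∀ k → k ℕ.< n → closedWalks A u k ≡ closedWalks A v k
  cospectral⇒initialClosedWalks u v cospectral = <-rec _ step
    where
    step : ∀ k → (∀ {i} → i ℕ.< k → i ℕ.< n → closedWalks A u i ≡ closedWalks A v i) →
           k ℕ.< n → closedWalks A u k ≡ closedWalks A v k
    step k earlier k<n = cancel-unit (lower u) (lower v)
      (trans (sym (relation u)) (trans (cospectral d) (relation v))) same-lower
      where
      d : ℕ
      d = n ∸ suc k
      d+k+1≡n : d ℕ.+ suc k ≡ n
      d+k+1≡n = NP.m∸n+n≡m k<n
      lower : Fin n → ℚ
      lower z = Σ< k (λ i → a (suc (d ℕ.+ i)) * closedWalks A z i)
      leading : a (suc (d ℕ.+ k)) ≡ 1ℚ
      leading = trans (cong a (trans (sym (NP.+-suc d k)) d+k+1≡n)) charPoly-monic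
      relation : ∀ z → coeff (charPoly (principalSubmatrix A z)) d ≡ lower z + closedWalks A z k
      relation z = trans (deletedCharPoly-walks z (suc k) d d+k+1≡n)
        (trans (Σ<-last k (λ i → a (suc (d ℕ.+ i)) * closedWalks A z i))
               (cong (lower z +_) (trans (cong (_* closedWalks A z k) leading) (QP.*-identityˡ _))))
      same-lower : lower u ≡ lower v
      same-lower = Σ<-cong k (λ i i<k → cong (a (suc (d ℕ.+ i)) *_) (earlier i<k (NP.<-trans i<k k<n)))
      cancel-unit : ∀ {x x′} S S′ → S + x ≡ S′ + x′ → S ≡ S′ → x ≡ x′
      cancel-unit {x} {x′} S S′ e refl = +-cancelˡ S x x′ e

  cospectral⇔sameClosedWalks : ∀ u v → Cospectral′ u v ⇔ SameClosedWalks A u v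
  cospectral⇔sameClosedWalks u v = mk⇔
    (λ cospectral → sameClosedWalks-fromInitial u v (cospectral⇒initialClosedWalks u v cospectral))
    (sameClosedWalks⇒cospectral u v)

module Orthogonality {m : ℕ} (A : Mat (suc m)) (symmetric : ∀ i j → A i j ≡ A j i) where

  open ClosedWalkRecurrence A using (sameClosedWalks-fromInitial)

  n : ℕ
  n = suc m

  -- The Gram matrix of a Krylov matrix: (W_zᵀ W_z)_jk = eᵀ_z A^j A^k e_z = (A^(j+k))_zz.
  krylov-gram : ∀ z (j k : Fin n) →
    (transpose (krylov A z) ⊗ krylov A z) j k ≡ closedWalks A z (toℕ j ℕ.+ toℕ k)
  krylov-gram z j k = trans (Σ-cong (λ i → cong (_* (A ^M toℕ k) i z) (^M-sym A symmetric (toℕ j) i z)))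
                            (sym (^M-+ A (toℕ j) (toℕ k) z z))

  SameGram : Fin n → Fin n → Set
  SameGram u v = (transpose (krylov A v) ⊗ krylov A v) ≈M (transpose (krylov A u) ⊗ krylov A u)

  -- The Gram matrices agree iff all closed walk counts do: the entries in
  -- row 0 are the counts of lengths < n, which determine all others.
  sameGram⇔sameClosedWalks : ∀ u v → SameGram u v ⇔ SameClosedWalks A u v
  sameGram⇔sameClosedWalks u v = mk⇔
    (λ gram → sameClosedWalks-fromInitial u v (λ k k<n → begin
        closedWalks A u k
      ≡⟨ cong (closedWalks A u) (sym (FP.toℕ-fromℕ< k<n)) ⟩
        closedWalks A u (toℕ (F.fromℕ< k<n))
      ≡⟨ sym (krylov-gram u zero (F.fromℕ< k<n)) ⟩
        (transpose (krylov A u) ⊗ krylov A u) zero (F.fromℕ< k<n)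
      ≡⟨ sym (gram zero (F.fromℕ< k<n)) ⟩
        (transpose (krylov A v) ⊗ krylov A v) zero (F.fromℕ< k<n)
      ≡⟨ krylov-gram v zero (F.fromℕ< k<n) ⟩
        closedWalks A v (toℕ (F.fromℕ< k<n))
      ≡⟨ cong (closedWalks A v) (FP.toℕ-fromℕ< k<n) ⟩
        closedWalks A v k ∎))
    (λ same j k → trans (krylov-gram v j k)
                        (trans (sym (same (toℕ j ℕ.+ toℕ k))) (sym (krylov-gram u j k))))
    where open ≡-Reasoning

  module _ (u v : Fin n) (Wu⁻¹ : Mat n) (inverse : IsInverse (krylov A u) Wu⁻¹) where

    private
      Wu Wv Q : Mat n
      Wu = krylov A u
      Wv = krylov A v
      Q  = Wv ⊗ Wu⁻¹
      WuWu⁻¹≈I : (Wu ⊗ Wu⁻¹) ≈M idM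
      WuWu⁻¹≈I = proj₁ inverse
      Wu⁻¹Wu≈I : (Wu⁻¹ ⊗ Wu) ≈M idM
      Wu⁻¹Wu≈I = proj₂ inverse

    -- Q W_u = W_v, so W_vᵀ W_v = W_uᵀ (QᵀQ) W_u; hence QᵀQ = I iff the Gram
    -- matrices of W_u and W_v agree.
    orthogonal⇒sameGram : Orthogonal Q → SameGram u v
    orthogonal⇒sameGram orthogonal = begin
        transpose Wv ⊗ Wv
      ≈⟨ ⊗-cong (transpose-cong (≈M-sym QWu≈Wv)) (≈M-sym QWu≈Wv) ⟩
        transpose (Q ⊗ Wu) ⊗ (Q ⊗ Wu)
      ≈⟨ ⊗-congʳ (Q ⊗ Wu) (transpose-⊗ Q Wu) ⟩
        (transpose Wu ⊗ transpose Q) ⊗ (Q ⊗ Wu)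
      ≈⟨ ⊗-assoc (transpose Wu) (transpose Q) (Q ⊗ Wu) ⟩
        transpose Wu ⊗ (transpose Q ⊗ (Q ⊗ Wu))
      ≈⟨ ⊗-congˡ (transpose Wu) (≈M-sym (⊗-assoc (transpose Q) Q Wu)) ⟩
        transpose Wu ⊗ ((transpose Q ⊗ Q) ⊗ Wu)
      ≈⟨ ⊗-congˡ (transpose Wu) (⊗-congʳ Wu orthogonal) ⟩
        transpose Wu ⊗ (idM ⊗ Wu)
      ≈⟨ ⊗-congˡ (transpose Wu) (⊗-identityˡ Wu) ⟩
        transpose Wu ⊗ Wu ∎
      where
      open SetoidReasoning (matSetoid n)
      QWu≈Wv : (Q ⊗ Wu) ≈M Wv
      QWu≈Wv = ≈M-trans (⊗-assoc Wv Wu⁻¹ Wu) (≈M-trans (⊗-congˡ Wv Wu⁻¹Wu≈I) (⊗-identityʳ Wv))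

    sameGram⇒orthogonal : SameGram u v → Orthogonal Q
    sameGram⇒orthogonal gram = begin
        transpose Q ⊗ Q
      ≈⟨ ⊗-congʳ Q (transpose-⊗ Wv Wu⁻¹) ⟩
        (transpose Wu⁻¹ ⊗ transpose Wv) ⊗ (Wv ⊗ Wu⁻¹)
      ≈⟨ ⊗-assoc (transpose Wu⁻¹) (transpose Wv) (Wv ⊗ Wu⁻¹) ⟩
        transpose Wu⁻¹ ⊗ (transpose Wv ⊗ (Wv ⊗ Wu⁻¹))
      ≈⟨ ⊗-congˡ (transpose Wu⁻¹) (≈M-sym (⊗-assoc (transpose Wv) Wv Wu⁻¹)) ⟩
        transpose Wu⁻¹ ⊗ ((transpose Wv ⊗ Wv) ⊗ Wu⁻¹)
      ≈⟨ ⊗-congˡ (transpose Wu⁻¹) (⊗-congʳ Wu⁻¹ gram) ⟩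
        transpose Wu⁻¹ ⊗ ((transpose Wu ⊗ Wu) ⊗ Wu⁻¹)
      ≈⟨ ⊗-congˡ (transpose Wu⁻¹) (⊗-assoc (transpose Wu) Wu Wu⁻¹) ⟩
        transpose Wu⁻¹ ⊗ (transpose Wu ⊗ (Wu ⊗ Wu⁻¹))
      ≈⟨ ⊗-congˡ (transpose Wu⁻¹) (≈M-trans (⊗-congˡ (transpose Wu) WuWu⁻¹≈I) (⊗-identityʳ (transpose Wu))) ⟩
        transpose Wu⁻¹ ⊗ transpose Wu
      ≈⟨ ≈M-sym (transpose-⊗ Wu Wu⁻¹) ⟩
        transpose (Wu ⊗ Wu⁻¹)
      ≈⟨ transpose-cong WuWu⁻¹≈I ⟩
        transpose idM
      ≈⟨ (λ i j → idM-sym j i) ⟩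
        idM ∎
      where open SetoidReasoning (matSetoid n)

    orthogonal⇔sameClosedWalks : Orthogonal Q ⇔ SameClosedWalks A u v
    orthogonal⇔sameClosedWalks =
      ⇔.trans (mk⇔ orthogonal⇒sameGram sameGram⇒orthogonal) (sameGram⇔sameClosedWalks u v)

adjMat-symmetric : ∀ {n} (X : SimpleGraph n) i j → adjMat X i j ≡ adjMat X j i
adjMat-symmetric X i j = cong (λ b → if b then 1ℚ else 0ℚ) (SimpleGraph.symm X i j)

-- Lemma 8.1, for A the adjacency matrix.
lemma8p1 : (m : ℕ) (X : SimpleGraph (suc m)) (u v : Fin (suc m))
           → (Wu⁻¹ : Mat (suc m)) → IsInverse (walkMat X u) Wu⁻¹
           → Controllable X v
           → IsPolynomialIn (walkMat X v ⊗ Wu⁻¹) (adjMat X)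
             × (Orthogonal (walkMat X v ⊗ Wu⁻¹) ⇔ Cospectral X u v)
lemma8p1 m X u v Wu⁻¹ inverse _ =
    quotient-isPolynomial A u v Wu⁻¹ (proj₁ inverse)
  , ⇔.trans (orthogonal⇔sameClosedWalks u v Wu⁻¹ inverse)
            (⇔.sym (cospectral⇔sameClosedWalks u v))
  where
  A : Mat (suc m)
  A = adjMat X
  open Orthogonality A (adjMat-symmetric X) using (orthogonal⇔sameClosedWalks)
  open DeletedCharPoly A using (cospectral⇔sameClosedWalks)
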